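{- Let $G_1,\dots,G_n$ be simple connected graphs, each with at least one edge, $m_i=|E(G_i)|$, and let $G=G_1\oplus_{v_{1,2}}G_2\oplus_{v_{2,3}}\cdots\oplus_{v_{n-1,n}}G_n$ be the chain of 1-sums described in the context. For $i\neq j$ define $v_{q_{i,j}}=v_{j-1,j}$ if $j>i$ and $v_{q_{i,j}}=v_{j,j+1}$ if $j<i$. Then $$\mathscr{K}(G)=\frac{\sum_{i=1}^n m_i\left(\mathscr{K}(G_i)+\sum_{j\ne i}\mu(G_j,v_{q_{i,j}})\right)+2\sum_{1\le i<j\le n,\ j-i\ge2} m_im_j\, r_G(v_{i,i+1},v_{j-1,j})}{\sum_{i=1}^n m_i}.$$
   Context: All graphs are finite, simple, undirected. For a connected graph $H$ with Laplacian $L$, the effective resistance is $r_H(i,j)=(e_i-e_j)^TL^\dagger(e_i-e_j)$ ($L^\dagger$ the Moore–Penrose pseudoinverse), i.e. the resistance between $i$ and $j$ with unit resistors on edges. For a connected graph $H$ with $m\ge1$ edges and degrees $d_i$, Kemeny's constant is $\mathscr{K}(H)=\sum_j\pi_jm_{ij}$ for the simple random walk on $H$ ($\pi_j=d_j/2m$, $m_{ij}$ expected hitting time of $j$ from $i$, $m_{jj}=0$), which equals $\frac{1}{4m}\sum_{i,j}d_id_jr_H(i,j)$. The moment of a vertex $v$ of $H$ is $\mu(H,v)=\sum_{i\in V(H)}d_i\,r_H(i,v)$. The chain 1-sum $G_1\oplus_{v_{1,2}}G_2\oplus\cdots\oplus_{v_{n-1,n}}G_n$ is obtained from the disjoint union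 of $G_1,\dots,G_n$ by, for each $i=1,\dots,n-1$, identifying a chosen vertex of $G_i$ with a chosen vertex of $G_{i+1}$; the resulting vertex is called $v_{i,i+1}$ and belongs to both $G_i$ and $G_{i+1}$ (the vertices $v_{i-1,i}$ and $v_{i,i+1}$ of $G_i$ may coincide). -}

module Defs where

open import Data.Nat as ℕ using (ℕ; zero; suc; _<ᵇ_)
open import Data.Bool using (Bool; true; false; if_then_else_; _∧_; _∨_)
open import Data.Fin using (Fin; zero; suc; toℕ; inject₁; splitAt; punchIn; punchOut; _↑ˡ_; _↑ʳ_)
open import Data.Fin.Properties using (_≟_)
open import Data.Sum using (inj₁; inj₂)
open import Data.Maybe using (Maybe; just; nothing)
open import Data.Product using (_×_)
open import Data.Integer using (+_)
open import Data.Rational using (ℚ; 0ℚ; _+_; _*_; -_; _/_)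
open import Relation.Nullary using (yes; no; does; ¬_)
open import Relation.Binary.PropositionalEquality using (_≡_; _≢_; refl)

record Graph : Set where
  constructor mkGraph
  field
    n   : ℕ
    adj : Fin n → Fin n → Bool
open Graph public

V : Graph → Set
V G = Fin (n G)

IsSimple : Graph → Set
IsSimple G = (∀ i j → adj G i j ≡ adj G j i) × (∀ i → adj G i i ≡ false)

data Walk (G : Graph) : V G → V G → Set where
  here : ∀ {i} → Walk G i i
  step : ∀ {i j k} → adj G i j ≡ true → Walk G j k → Walk G i k

Connected : Graph → Set
Connected G = ∀ i j → Walk G i j

Σℚ : (k : ℕ) → (Fin k → ℚ) → ℚ
Σℚ zero    f = 0ℚ
Σℚ (suc k) f = f zero + Σℚ k (λ i → f (suc i))

Σℕ : (k : ℕ) → (Fin k → ℕ) → ℕ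
Σℕ zero    f = 0
Σℕ (suc k) f = f zero ℕ.+ Σℕ k (λ i → f (suc i))

count : (k : ℕ) → (Fin k → Bool) → ℕ
count k p = Σℕ k (λ i → if p i then 1 else 0)

Σ≠ : {k : ℕ} → (i : Fin k) → ((j : Fin k) → i ≢ j → ℚ) → ℚ
Σ≠ {k} i f = Σℚ k (λ j → g j (i ≟ j))
  where
  g : (j : Fin k) → Relation.Nullary.Dec (i ≡ j) → ℚ
  g j (yes _) = 0ℚ
  g j (no p)  = f j p

ℕ→ℚ : ℕ → ℚ
ℕ→ℚ k = + k / 1

-- 1/k for k ≥ 1 (junk value 0 for k = 0; only used with k ≥ 1)
inv : ℕ → ℚ
inv zero    = 0ℚ
inv (suc k) = + 1 / suc k

deg : (G : Graph) → V G → ℕ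
deg G i = count (n G) (adj G i)

edges : Graph → ℕ
edges G = Σℕ (n G) (λ i → count (n G) (λ j → (toℕ i <ᵇ toℕ j) ∧ adj G i j))

Mat : ℕ → Set
Mat k = Fin k → Fin k → ℚ

_·_ : {k : ℕ} → Mat k → Mat k → Mat k
_·_ {k} A B i j = Σℚ k (λ t → A i t * B t j)

transpose : {k : ℕ} → Mat k → Mat k
transpose A i j = A j i

Laplacian : (G : Graph) → Mat (n G)
Laplacian G i j =
  if does (i ≟ j) then ℕ→ℚ (deg G i)
  else (if adj G i j then - ℕ→ℚ 1 else 0ℚ)

IsPseudoinverse : {k : ℕ} → Mat k → Mat k → Set
IsPseudoinverse A X =
  (∀ i j → ((A · X) · A) i j ≡ A i j) ×
  (∀ i j → ((X · A) · X) i j ≡ X i j) ×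
  (∀ i j → transpose (A · X) i j ≡ (A · X) i j) ×
  (∀ i j → transpose (X · A) i j ≡ (X · A) i j)

-- effective resistance, Kemeny's constant, moment
-- (each takes X, which is to be the pseudoinverse of the Laplacian)

-- r(i,j) = (e_i - e_j)^T X (e_i - e_j)
resistance : (G : Graph) → Mat (n G) → V G → V G → ℚ
resistance G X i j = (X i i + X j j) + - (X i j + X j i)

kemeny : (G : Graph) → Mat (n G) → ℚ
kemeny G X =
  inv (4 ℕ.* edges G) *
  Σℚ (n G) (λ i → Σℚ (n G) (λ j →
     (ℕ→ℚ (deg G i) * ℕ→ℚ (deg G j)) * resistance G X i j))

moment : (G : Graph) → Mat (n G) → V G → ℚ
moment G X v = Σℚ (n G) (λ i → ℕ→ℚ (deg G i) * resistance G X i v)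

-- Vertex set: Fin (n H + (n K - 1)); the first n H vertices are those of
-- H, the remaining ones are the vertices of K other than w (via punchIn w).

oneSum : (H : Graph) → V H → (K : Graph) → V K → Graph
oneSum H u (mkGraph zero adjK) ()
oneSum H u (mkGraph (suc k) adjK) w = mkGraph (n H ℕ.+ k) adjS
  where
  inH : Fin (n H ℕ.+ k) → Maybe (Fin (n H))
  inH a with splitAt (n H) a
  ... | inj₁ x = just x
  ... | inj₂ _ = nothing
  inK : Fin (n H ℕ.+ k) → Maybe (Fin (suc k))
  inK a with splitAt (n H) a
  ... | inj₁ x = if does (x ≟ u) then just w else nothing
  ... | inj₂ y = just (punchIn w y)
  adjM : {m : ℕ} → (Fin m → Fin m → Bool) → Maybe (Fin m) → Maybe (Fin m) → Bool
  adjM A (just x) (just y) = A x y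
  adjM A _ _ = false
  adjS : Fin (n H ℕ.+ k) → Fin (n H ℕ.+ k) → Bool
  adjS a b = adjM (adj H) (inH a) (inH b) ∨ adjM adjK (inK a) (inK b)

embH : (H : Graph) (u : V H) (K : Graph) (w : V K) → V H → V (oneSum H u K w)
embH H u (mkGraph zero adjK) ()
embH H u (mkGraph (suc k) adjK) w x = x ↑ˡ k

embK : (H : Graph) (u : V H) (K : Graph) (w : V K) → V K → V (oneSum H u K w)
embK H u (mkGraph zero adjK) ()
embK H u (mkGraph (suc k) adjK) w y with w ≟ y
... | yes _ = u ↑ˡ k
... | no p  = n H ↑ʳ punchOut p

-- Chain 1-sum G_0 ⊕ G_1 ⊕ ⋯ ⊕ G_k  (0-based indices; n = k+1 graphs).
--   rv t : the vertex v_{t,t+1} as a vertex of G_t      (t : Fin k)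
--   lv t : the vertex v_{t,t+1} as a vertex of G_{t+1}  (t : Fin k)
-- G_0 ⊕ (G_1 ⊕ ⋯ ⊕ G_k), gluing rv 0 ∈ G_0 to (the image of) lv 0 ∈ G_1.

RV : (k : ℕ) → (Fin (suc k) → Graph) → Set
RV k Gs = (t : Fin k) → V (Gs (inject₁ t))

LV : (k : ℕ) → (Fin (suc k) → Graph) → Set
LV k Gs = (t : Fin k) → V (Gs (suc t))

mutual
  chainSum : (k : ℕ) (Gs : Fin (suc k) → Graph) → RV k Gs → LV k Gs → Graph
  chainSum zero    Gs rv lv = Gs zero
  chainSum (suc k) Gs rv lv =
    oneSum (Gs zero) (rv zero)
           (chainSum k (λ i → Gs (suc i)) (λ t → rv (suc t)) (λ t → lv (suc t)))
           (emb k (λ i → Gs (suc i)) (λ t → rv (suc t)) (λ t → lv (suc t)) zero (lv zero))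

  emb : (k : ℕ) (Gs : Fin (suc k) → Graph) (rv : RV k Gs) (lv : LV k Gs) →
        (i : Fin (suc k)) → V (Gs i) → V (chainSum k Gs rv lv)
  emb zero    Gs rv lv zero x = x
  emb (suc k) Gs rv lv zero x =
    embH (Gs zero) (rv zero)
         (chainSum k (λ i → Gs (suc i)) (λ t → rv (suc t)) (λ t → lv (suc t)))
         (emb k (λ i → Gs (suc i)) (λ t → rv (suc t)) (λ t → lv (suc t)) zero (lv zero)) x
  emb (suc k) Gs rv lv (suc i) x =
    embK (Gs zero) (rv zero)
         (chainSum k (λ i → Gs (suc i)) (λ t → rv (suc t)) (λ t → lv (suc t)))
         (emb k (λ i → Gs (suc i)) (λ t → rv (suc t)) (λ t → lv (suc t)) zero (lv zero))
         (emb k (λ i → Gs (suc i)) (λ t → rv (suc t)) (λ t → lv (suc t)) i x)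

glue : (k : ℕ) (Gs : Fin (suc k) → Graph) (rv : RV k Gs) (lv : LV k Gs) →
       Fin k → V (chainSum k Gs rv lv)
glue k Gs rv lv t = emb k Gs rv lv (inject₁ t) (rv t)

-- v_{q_{i,j}} ∈ V(G_j) for i ≠ j:
--   j > i : v_{j-1,j} (= lv (j-1)),   j < i : v_{j,j+1} (= rv j).
q : (k : ℕ) (Gs : Fin (suc k) → Graph) (rv : RV k Gs) (lv : LV k Gs) →
    (i j : Fin (suc k)) → i ≢ j → V (Gs j)
q k       Gs rv lv zero    zero    p = Data.Empty.⊥-elim (p refl)
  where import Data.Empty
q (suc k) Gs rv lv zero    (suc j) p = lv j
q (suc k) Gs rv lv (suc i) zero    p = rv zero
q (suc k) Gs rv lv (suc i) (suc j) p =
  q k (λ t → Gs (suc t)) (λ t → rv (suc t)) (λ t → lv (suc t)) i j (λ e → p (Relation.Binary.PropositionalEquality.cong suc e))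
q zero    Gs rv lv zero    (suc ()) p
q zero    Gs rv lv (suc ()) j p

-- Effective resistances are read off potentials: r(a,b) = y a - y b for any y with L y = e_a - e_b.
-- On a connected graph the maximum principle makes this drop independent of y, and the Penrose
-- equations show that X e_a - X e_b is such a potential, so the resistance built from the
-- pseudoinverse X is the effective resistance. In a 1-sum H ⊕ K, potentials of H and K shifted to
-- vanish at the cut vertex glue together; hence resistances inside H or K are unchanged, and
-- r(a,c) = r_H(a,u) + r_K(w,c) across the cut vertex. Summing d_i d_j r(i,j) over the 1-sum gives the
-- two internal sums plus 2 (vol K · μ_H(u) + vol H · μ_K(w)). Peeling G₁ off the chain, the moment of
-- the rest at the glue vertex splits again across the cut vertices, producing the terms μ(G_j, v_{q_{i,j}})
-- and the resistances between glue vertices; finally vol = 2m (handshake) turns volumes into edge counts.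

module Submission where

open import Defs
open import Algebra.Bundles using (Ring)
open import Data.Bool using (Bool; true; false; if_then_else_; _∧_)
open import Data.Bool.Properties using (∨-identityʳ)
open import Data.Empty using (⊥-elim)
open import Data.Fin using (Fin; zero; suc; toℕ; inject₁; _↑ˡ_; _↑ʳ_; punchIn; punchOut; splitAt; join)
open import Data.Fin.Properties using (_≟_; toℕ-injective; splitAt-↑ˡ; splitAt-↑ʳ; join-splitAt; punchIn-punchOut; punchOut-punchIn; punchOut-cong; punchInᵢ≢i; ↑ˡ-injective; ↑ʳ-injective; punchIn-injective)
open import Data.Integer using () renaming (+_ to pos; _+_ to _+ℤ_)
import Data.Integer.Properties as ℤ
open import Data.List using (allFin)
open import Data.List.Membership.Propositional.Properties using (∈-allFin)
import Data.List.Relation.Unary.All as All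
open import Data.Nat as ℕ using (ℕ; zero; suc; _≤_; _<ᵇ_; s≤s; z≤n)
import Data.Nat.Properties as ℕ
open import Data.Nat.Coprimality using (1-coprimeTo) renaming (sym to coprime-sym)
open import Data.Product using (Σ; _×_; _,_; proj₁; proj₂)
open import Data.Rational as ℚ using (ℚ; 0ℚ; 1ℚ; ½; _+_; _*_; -_; _-_; _/_; mkℚ)
import Data.Rational.Properties as ℚ
open import Data.Rational.Solver using (module +-*-Solver)
open import Data.Sum using (_⊎_; inj₁; inj₂; [_,_]′)
open import Relation.Binary.Bundles using (DecTotalOrder)
open import Relation.Binary.PropositionalEquality
open import Relation.Nullary using (Dec; yes; no; does; ¬_; contradiction)
open import Relation.Nullary.Reflects using (ofʸ; ofⁿ)
open import Algebra.Properties.Semiring.Sum (Ring.semiring ℚ.+-*-ring) using (sum; ∑-comm; sum-remove)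
open import Algebra.Properties.Group ℚ.+-0-group using (x∙y⁻¹≈ε⇒x≈y)
open import Algebra.Properties.Ring ℚ.+-*-ring using (x[y-z]≈xy-xz)
open import Data.List.Extrema (DecTotalOrder.totalOrder ℚ.≤-decTotalOrder) using (argmax; f[xs]≤f[argmax])

open +-*-Solver
open ≡-Reasoning

ℕ→ℚ≡mkℚ : ∀ a → ℕ→ℚ a ≡ mkℚ (pos a) 0 (coprime-sym (1-coprimeTo a))
ℕ→ℚ≡mkℚ a = ℚ.normalize-coprime _

ℕ→ℚ-homo-+ : ∀ a b → ℕ→ℚ (a ℕ.+ b) ≡ ℕ→ℚ a + ℕ→ℚ b
ℕ→ℚ-homo-+ a b rewrite ℕ→ℚ≡mkℚ a | ℕ→ℚ≡mkℚ b =
  cong (_/ 1) (cong₂ _+ℤ_ (sym (ℤ.*-identityʳ (pos a))) (sym (ℤ.*-identityʳ (pos b))))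

ℕ→ℚ-homo-* : ∀ a b → ℕ→ℚ (a ℕ.* b) ≡ ℕ→ℚ a * ℕ→ℚ b
ℕ→ℚ-homo-* a b rewrite ℕ→ℚ≡mkℚ a | ℕ→ℚ≡mkℚ b = cong (_/ 1) (ℤ.pos-* a b)

ℕ→ℚ-injective : ∀ {a b} → ℕ→ℚ a ≡ ℕ→ℚ b → a ≡ b
ℕ→ℚ-injective {a} {b} e =
  ℤ.+-injective (cong ℚ.numerator (trans (sym (ℕ→ℚ≡mkℚ a)) (trans e (ℕ→ℚ≡mkℚ b))))

ℕ→ℚ*inv≡1 : ∀ {a} → 1 ≤ a → ℕ→ℚ a * inv a ≡ 1ℚ
ℕ→ℚ*inv≡1 {suc a} _ rewrite ℕ→ℚ≡mkℚ (suc a) | ℚ.normalize-coprime (1-coprimeTo (suc a)) =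
  ℚ.*-inverseʳ (mkℚ (pos (suc a)) 0 (coprime-sym (1-coprimeTo (suc a))))

inv-homo-* : ∀ {a b} → 1 ≤ a → 1 ≤ b → inv (a ℕ.* b) ≡ inv a * inv b
inv-homo-* {a} {b} 1≤a 1≤b = begin
  x                                ≡⟨ ℚ.*-identityʳ x ⟨
  x * (1ℚ * 1ℚ)                    ≡⟨ cong (x *_) (cong₂ _*_ (ℕ→ℚ*inv≡1 1≤a) (ℕ→ℚ*inv≡1 1≤b)) ⟨
  x * ((A * ia) * (B * ib))        ≡⟨ solve 5 (λ x A B ia ib → x :* ((A :* ia) :* (B :* ib)) := ((A :* B) :* x) :* (ia :* ib)) refl x A B ia ib ⟩
  ((A * B) * x) * (ia * ib)        ≡⟨ cong (λ z → (z * x) * (ia * ib)) (ℕ→ℚ-homo-* a b) ⟨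
  (ℕ→ℚ (a ℕ.* b) * x) * (ia * ib)  ≡⟨ cong (_* (ia * ib)) (ℕ→ℚ*inv≡1 (ℕ.*-mono-≤ 1≤a 1≤b)) ⟩
  1ℚ * (ia * ib)                   ≡⟨ ℚ.*-identityˡ (ia * ib) ⟩
  ia * ib                          ∎
  where
  x = inv (a ℕ.* b)
  A = ℕ→ℚ a
  B = ℕ→ℚ b
  ia = inv a
  ib = inv b

Σℚ-cong : ∀ k {f g : Fin k → ℚ} → (∀ i → f i ≡ g i) → Σℚ k f ≡ Σℚ k g
Σℚ-cong zero    e = refl
Σℚ-cong (suc k) e = cong₂ _+_ (e zero) (Σℚ-cong k (λ i → e (suc i)))

Σℚ≡sum : ∀ k (f : Fin k → ℚ) → Σℚ k f ≡ sum f
Σℚ≡sum zero    f = refl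
Σℚ≡sum (suc k) f = cong (f zero +_) (Σℚ≡sum k (λ i → f (suc i)))

Σℚ-0 : ∀ k → Σℚ k (λ _ → 0ℚ) ≡ 0ℚ
Σℚ-0 zero    = refl
Σℚ-0 (suc k) = cong (0ℚ +_) (Σℚ-0 k)

Σℚ-+ : ∀ k (f g : Fin k → ℚ) → Σℚ k (λ i → f i + g i) ≡ Σℚ k f + Σℚ k g
Σℚ-+ zero    f g = refl
Σℚ-+ (suc k) f g = begin
  (f zero + g zero) + Σℚ k (λ i → f (suc i) + g (suc i))  ≡⟨ cong ((f zero + g zero) +_) (Σℚ-+ k _ _) ⟩
  (f zero + g zero) + (Σℚ k (λ i → f (suc i)) + Σℚ k (λ i → g (suc i)))
    ≡⟨ solve 4 (λ a b c d → (a :+ b) :+ (c :+ d) := (a :+ c) :+ (b :+ d)) refl (f zero) (g zero) _ _ ⟩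
  Σℚ (suc k) f + Σℚ (suc k) g  ∎

Σℚ-neg : ∀ k (f : Fin k → ℚ) → Σℚ k (λ i → - f i) ≡ - Σℚ k f
Σℚ-neg zero    f = refl
Σℚ-neg (suc k) f = trans (cong (- f zero +_) (Σℚ-neg k (λ i → f (suc i)))) (sym (ℚ.neg-distrib-+ (f zero) _))

Σℚ-sub : ∀ k (f g : Fin k → ℚ) → Σℚ k (λ i → f i - g i) ≡ Σℚ k f - Σℚ k g
Σℚ-sub k f g = trans (Σℚ-+ k f (λ i → - g i)) (cong (Σℚ k f +_) (Σℚ-neg k g))

Σℚ-*ˡ : ∀ k c (f : Fin k → ℚ) → Σℚ k (λ i → c * f i) ≡ c * Σℚ k f
Σℚ-*ˡ zero    c f = sym (ℚ.*-zeroʳ c)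
Σℚ-*ˡ (suc k) c f = trans (cong (c * f zero +_) (Σℚ-*ˡ k c (λ i → f (suc i)))) (sym (ℚ.*-distribˡ-+ c (f zero) _))

Σℚ-*ʳ : ∀ k c (f : Fin k → ℚ) → Σℚ k (λ i → f i * c) ≡ Σℚ k f * c
Σℚ-*ʳ k c f = trans (Σℚ-cong k (λ i → ℚ.*-comm (f i) c)) (trans (Σℚ-*ˡ k c f) (ℚ.*-comm c _))

Σℚ-comm : ∀ a b (f : Fin a → Fin b → ℚ) → Σℚ a (λ i → Σℚ b (f i)) ≡ Σℚ b (λ j → Σℚ a (λ i → f i j))
Σℚ-comm a b f = begin
  Σℚ a (λ i → Σℚ b (f i))            ≡⟨ trans (Σℚ-cong a (λ i → Σℚ≡sum b (f i))) (Σℚ≡sum a _) ⟩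
  sum (λ i → sum (f i))              ≡⟨ ∑-comm f ⟩
  sum (λ j → sum (λ i → f i j))      ≡⟨ trans (Σℚ-cong b (λ j → Σℚ≡sum a (λ i → f i j))) (Σℚ≡sum b _) ⟨
  Σℚ b (λ j → Σℚ a (λ i → f i j))    ∎

Σℚ-punchIn : ∀ k (w : Fin (suc k)) (f : Fin (suc k) → ℚ) → Σℚ (suc k) f ≡ f w + Σℚ k (λ j → f (punchIn w j))
Σℚ-punchIn k w f = begin
  Σℚ (suc k) f                        ≡⟨ Σℚ≡sum (suc k) f ⟩
  sum f                               ≡⟨ sum-remove f ⟩
  f w + sum (λ j → f (punchIn w j))   ≡⟨ cong (f w +_) (Σℚ≡sum k _) ⟨
  f w + Σℚ k (λ j → f (punchIn w j))  ∎

Σℚ-↑ : ∀ m k (f : Fin (m ℕ.+ k) → ℚ) → Σℚ (m ℕ.+ k) f ≡ Σℚ m (λ i → f (i ↑ˡ k)) + Σℚ k (λ j → f (m ↑ʳ j))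
Σℚ-↑ zero    k f = sym (ℚ.+-identityˡ _)
Σℚ-↑ (suc m) k f = trans (cong (f zero +_) (Σℚ-↑ m k (λ i → f (suc i)))) (sym (ℚ.+-assoc (f zero) _ _))

ℕ→ℚ-homo-Σ : ∀ k (f : Fin k → ℕ) → ℕ→ℚ (Σℕ k f) ≡ Σℚ k (λ i → ℕ→ℚ (f i))
ℕ→ℚ-homo-Σ zero    f = refl
ℕ→ℚ-homo-Σ (suc k) f = trans (ℕ→ℚ-homo-+ (f zero) _) (cong (ℕ→ℚ (f zero) +_) (ℕ→ℚ-homo-Σ k (λ i → f (suc i))))

2*-injective : ∀ {x y} → ℕ→ℚ 2 * x ≡ ℕ→ℚ 2 * y → x ≡ y
2*-injective {x} {y} 2x≡2y = begin
  x                  ≡⟨ halve x ⟩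
  ½ * (ℕ→ℚ 2 * x)    ≡⟨ cong (½ *_) 2x≡2y ⟩
  ½ * (ℕ→ℚ 2 * y)    ≡⟨ halve y ⟨
  y                  ∎
  where
  halve : ∀ z → z ≡ ½ * (ℕ→ℚ 2 * z)
  halve = solve 1 (λ z → z := con ½ :* (con (ℕ→ℚ 2) :* z)) refl

if-*ˡ : ∀ (b : Bool) c x → (if b then c * x else 0ℚ) ≡ c * (if b then x else 0ℚ)
if-*ˡ true  c x = refl
if-*ˡ false c x = sym (ℚ.*-zeroʳ c)

p≤q⇒0≤q-p : ∀ {p q} → p ℚ.≤ q → 0ℚ ℚ.≤ q - p
p≤q⇒0≤q-p {p} {q} p≤q = subst (ℚ._≤ q - p) (ℚ.+-inverseʳ p) (ℚ.+-monoˡ-≤ (- p) p≤q)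

nonneg+nonneg≡0 : ∀ {p q} → 0ℚ ℚ.≤ p → 0ℚ ℚ.≤ q → p + q ≡ 0ℚ → p ≡ 0ℚ × q ≡ 0ℚ
nonneg+nonneg≡0 {p} {q} 0≤p 0≤q p+q≡0 = p≡0 , trans (sym (ℚ.+-identityˡ q)) (trans (cong (_+ q) (sym p≡0)) p+q≡0)
  where
  p≡0 : p ≡ 0ℚ
  p≡0 = ℚ.≤-antisym (subst₂ ℚ._≤_ (ℚ.+-identityʳ p) p+q≡0 (ℚ.+-monoʳ-≤ p 0≤q)) 0≤p

Σℚ-nonneg : ∀ k (f : Fin k → ℚ) → (∀ i → 0ℚ ℚ.≤ f i) → 0ℚ ℚ.≤ Σℚ k f
Σℚ-nonneg zero    f 0≤f = ℚ.≤-refl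
Σℚ-nonneg (suc k) f 0≤f = ℚ.+-mono-≤ (0≤f zero) (Σℚ-nonneg k (λ i → f (suc i)) (λ i → 0≤f (suc i)))

Σℚ-nonneg≡0 : ∀ k (f : Fin k → ℚ) → (∀ i → 0ℚ ℚ.≤ f i) → Σℚ k f ≡ 0ℚ → ∀ i → f i ≡ 0ℚ
Σℚ-nonneg≡0 (suc k) f 0≤f Σ≡0 i = split i (nonneg+nonneg≡0 (0≤f zero) (Σℚ-nonneg k _ (λ i → 0≤f (suc i))) Σ≡0)
  where
  split : ∀ i → f zero ≡ 0ℚ × Σℚ k (λ i → f (suc i)) ≡ 0ℚ → f i ≡ 0ℚ
  split zero    (f₀≡0 , _) = f₀≡0
  split (suc i) (_ , rest≡0) = Σℚ-nonneg≡0 k (λ i → f (suc i)) (λ i → 0≤f (suc i)) rest≡0 i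

[p-r]-[q-r]≡p-q : ∀ p q r → (p - r) - (q - r) ≡ p - q
[p-r]-[q-r]≡p-q = solve 3 (λ p q r → (p :- r) :- (q :- r) := p :- q) refl

[p-q]+[r-r]≡p-q : ∀ p q r → (p - q) + (r - r) ≡ p - q
[p-q]+[r-r]≡p-q = solve 3 (λ p q r → (p :- q) :+ (r :- r) := p :- q) refl

[p-p]+[q-r]≡q-r : ∀ p q r → (p - p) + (q - r) ≡ q - r
[p-p]+[q-r]≡q-r = solve 3 (λ p q r → (p :- p) :+ (q :- r) := q :- r) refl

[p-q]+[q-r]≡p-r : ∀ p q r → (p - q) + (q - r) ≡ p - r
[p-q]+[q-r]≡p-r = solve 3 (λ p q r → (p :- q) :+ (q :- r) := p :- r) refl

[p-p]-[q-r]≡r-q : ∀ p q r → (p - p) - (q - r) ≡ r - q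
[p-p]-[q-r]≡r-q = solve 3 (λ p q r → (p :- p) :- (q :- r) := r :- q) refl

[p-q]-[r-s]≡[p-q]+[s-r] : ∀ p q r s → (p - q) - (r - s) ≡ (p - q) + (s - r)
[p-q]-[r-s]≡[p-q]+[s-r] = solve 4 (λ p q r s → (p :- q) :- (r :- s) := (p :- q) :+ (s :- r)) refl

-- Laplacians, potentials and effective resistance

𝟙 : Bool → ℚ
𝟙 true  = 1ℚ
𝟙 false = 0ℚ

ℕ→ℚ-indicator : ∀ b → ℕ→ℚ (if b then 1 else 0) ≡ 𝟙 b
ℕ→ℚ-indicator true  = refl
ℕ→ℚ-indicator false = refl

ℕ→ℚ-deg : ∀ G x → ℕ→ℚ (deg G x) ≡ Σℚ (n G) (λ t → 𝟙 (adj G x t))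
ℕ→ℚ-deg G x = trans (ℕ→ℚ-homo-Σ (n G) _) (Σℚ-cong (n G) (λ t → ℕ→ℚ-indicator (adj G x t)))

δ : ∀ {k} → Fin k → Fin k → ℚ
δ a x = 𝟙 (does (a ≟ x))

δ-sym : ∀ {k} (a x : Fin k) → δ a x ≡ δ x a
δ-sym zero    zero    = refl
δ-sym zero    (suc x) = refl
δ-sym (suc a) zero    = refl
δ-sym (suc a) (suc x) = δ-sym a x

δ-refl : ∀ {k} (x : Fin k) → δ x x ≡ 1ℚ
δ-refl zero    = refl
δ-refl (suc x) = δ-refl x

δ-≢ : ∀ {k} {x y : Fin k} → x ≢ y → δ x y ≡ 0ℚ
δ-≢ {x = x} {y} x≢y with x ≟ y
... | yes x≡y = ⊥-elim (x≢y x≡y)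
... | no _    = refl

𝟙-∧ : ∀ b c → 𝟙 (b ∧ c) ≡ 𝟙 b * 𝟙 c
𝟙-∧ true  c = sym (ℚ.*-identityˡ (𝟙 c))
𝟙-∧ false c = sym (ℚ.*-zeroˡ (𝟙 c))

δ*-subst : ∀ {m} (a u : Fin m) (f : Fin m → ℚ) → δ a u * f a ≡ δ a u * f u
δ*-subst a u f with a ≟ u
... | yes refl = refl
... | no _     = trans (ℚ.*-zeroˡ (f a)) (sym (ℚ.*-zeroˡ (f u)))

δ-injective : ∀ {m l} {f : Fin m → Fin l} → (∀ x y → f x ≡ f y → x ≡ y) → ∀ x y → δ (f x) (f y) ≡ δ x y
δ-injective {f = f} f-inj x y with f x ≟ f y | x ≟ y
... | yes _    | yes _    = refl
... | no _     | no _     = refl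
... | yes fx≡fy | no x≢y  = ⊥-elim (x≢y (f-inj x y fx≡fy))
... | no fx≢fy | yes refl = ⊥-elim (fx≢fy refl)

Σℚ-δ : ∀ k (i : Fin k) (f : Fin k → ℚ) → Σℚ k (λ j → δ i j * f j) ≡ f i
Σℚ-δ (suc k) zero f = begin
  1ℚ * f zero + Σℚ k (λ j → 0ℚ * f (suc j))
    ≡⟨ cong₂ _+_ (ℚ.*-identityˡ (f zero)) (trans (Σℚ-cong k (λ j → ℚ.*-zeroˡ (f (suc j)))) (Σℚ-0 k)) ⟩
  f zero + 0ℚ  ≡⟨ ℚ.+-identityʳ _ ⟩
  f zero       ∎
Σℚ-δ (suc k) (suc i) f =
  trans (cong₂ _+_ (ℚ.*-zeroˡ (f zero)) (Σℚ-δ k i (λ j → f (suc j)))) (ℚ.+-identityˡ _)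

Σℚ-δʳ : ∀ k (i : Fin k) (f : Fin k → ℚ) → Σℚ k (λ j → δ j i * f j) ≡ f i
Σℚ-δʳ k i f = trans (Σℚ-cong k (λ j → cong (_* f j) (δ-sym j i))) (Σℚ-δ k i f)

laplace : (G : Graph) → (V G → ℚ) → V G → ℚ
laplace G y x = Σℚ (n G) (λ t → Laplacian G x t * y t)

laplacian-entry : ∀ {G} → IsSimple G → ∀ x t → Laplacian G x t ≡ δ x t * ℕ→ℚ (deg G x) - 𝟙 (adj G x t)
laplacian-entry {G} (_ , loopless) x t with x ≟ t
... | yes refl rewrite loopless x = solve 1 (λ d → d := con 1ℚ :* d :- con 0ℚ) refl (ℕ→ℚ (deg G x))
... | no _ with adj G x t
...   | true  = solve 1 (λ d → con (- 1ℚ) := con 0ℚ :* d :- con 1ℚ) refl (ℕ→ℚ (deg G x))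
...   | false = solve 1 (λ d → con 0ℚ := con 0ℚ :* d :- con 0ℚ) refl (ℕ→ℚ (deg G x))

laplacian-sym : ∀ {G} → IsSimple G → ∀ i j → Laplacian G i j ≡ Laplacian G j i
laplacian-sym {G} (symmetric , _) i j with i ≟ j | j ≟ i
... | yes refl | yes _   = refl
... | yes i≡j  | no j≢i  = ⊥-elim (j≢i (sym i≡j))
... | no i≢j   | yes j≡i = ⊥-elim (i≢j (sym j≡i))
... | no _     | no _    rewrite symmetric i j = refl

laplace-adjacency : ∀ {G} → IsSimple G → ∀ y x → laplace G y x ≡ Σℚ (n G) (λ t → 𝟙 (adj G x t) * (y x - y t))
laplace-adjacency {G} simple y x = begin
  Σℚ N (λ t → Laplacian G x t * y t)
    ≡⟨ Σℚ-cong N (λ t → cong (_* y t) (laplacian-entry simple x t)) ⟩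
  Σℚ N (λ t → (δ x t * D - A t) * y t)
    ≡⟨ Σℚ-cong N (λ t → solve 4 (λ d D a y → (d :* D :- a) :* y := d :* (D :* y) :- a :* y) refl (δ x t) D (A t) (y t)) ⟩
  Σℚ N (λ t → δ x t * (D * y t) - A t * y t)
    ≡⟨ Σℚ-sub N _ _ ⟩
  Σℚ N (λ t → δ x t * (D * y t)) - Σℚ N (λ t → A t * y t)
    ≡⟨ cong (_- Σℚ N (λ t → A t * y t)) (trans (Σℚ-δ N x (λ t → D * y t)) (cong (_* y x) (ℕ→ℚ-deg G x))) ⟩
  Σℚ N A * y x - Σℚ N (λ t → A t * y t)
    ≡⟨ cong (_- Σℚ N (λ t → A t * y t)) (Σℚ-*ʳ N (y x) A) ⟨
  Σℚ N (λ t → A t * y x) - Σℚ N (λ t → A t * y t)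
    ≡⟨ Σℚ-sub N _ _ ⟨
  Σℚ N (λ t → A t * y x - A t * y t)
    ≡⟨ Σℚ-cong N (λ t → solve 3 (λ a p q → a :* p :- a :* q := a :* (p :- q)) refl (A t) (y x) (y t)) ⟩
  Σℚ N (λ t → A t * (y x - y t)) ∎
  where
  N = n G
  D = ℕ→ℚ (deg G x)
  A : V G → ℚ
  A t = 𝟙 (adj G x t)

laplace-sub : ∀ G y z x → laplace G (λ t → y t - z t) x ≡ laplace G y x - laplace G z x
laplace-sub G y z x = trans
  (Σℚ-cong (n G) (λ t → solve 3 (λ l p q → l :* (p :- q) := l :* p :- l :* q) refl (Laplacian G x t) (y t) (z t)))
  (Σℚ-sub (n G) _ _)

laplace-neg : ∀ G y x → laplace G (λ t → - y t) x ≡ - laplace G y x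
laplace-neg G y x = trans (Σℚ-cong (n G) (λ t → sym (ℚ.neg-distribʳ-* (Laplacian G x t) (y t)))) (Σℚ-neg (n G) _)

𝟙*-nonneg : ∀ b {x} → 0ℚ ℚ.≤ x → 0ℚ ℚ.≤ 𝟙 b * x
𝟙*-nonneg true  {x} 0≤x = subst (0ℚ ℚ.≤_) (sym (ℚ.*-identityˡ x)) 0≤x
𝟙*-nonneg false {x} _   = subst (0ℚ ℚ.≤_) (sym (ℚ.*-zeroˡ x)) ℚ.≤-refl

-- Maximum principle: a neighbour of a vertex where y is maximal has the same value.
harmonic⇒constant : ∀ {G} → IsSimple G → Connected G → ∀ {y} → (∀ x → laplace G y x ≡ 0ℚ) → ∀ a b → y a ≡ y b
harmonic⇒constant {G} simple connected {y} harmonic a b = trans (atMax a) (sym (atMax b))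
  where
  IsMax : V G → Set
  IsMax i = ∀ t → y t ℚ.≤ y i
  m : V G
  m = argmax y a (allFin (n G))
  m-max : IsMax m
  m-max t = All.lookup (f[xs]≤f[argmax] a (allFin (n G))) (∈-allFin t)
  neighbour : ∀ {i} → IsMax i → ∀ j → adj G i j ≡ true → y j ≡ y i
  neighbour {i} i-max j i~j = sym (x∙y⁻¹≈ε⇒x≈y (y i) (y j) (trans (sym (ℚ.*-identityˡ _)) (subst (λ e → 𝟙 e * (y i - y j) ≡ 0ℚ) i~j
    (Σℚ-nonneg≡0 (n G) _ (λ t → 𝟙*-nonneg (adj G i t) (p≤q⇒0≤q-p (i-max t)))
      (trans (sym (laplace-adjacency simple y i)) (harmonic i)) j))))
  along : ∀ {i j} → Walk G i j → IsMax i → y j ≡ y i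
  along here i-max = refl
  along (step {j = j} i~j walk) i-max =
    let yj≡yi = neighbour i-max j i~j in
    trans (along walk (λ t → subst (y t ℚ.≤_) (sym yj≡yi) (i-max t))) yj≡yi
  atMax : ∀ c → y c ≡ y m
  atMax c = along (connected m c) m-max

IsPotential : (G : Graph) → V G → V G → (V G → ℚ) → Set
IsPotential G a b y = ∀ x → laplace G y x ≡ δ a x - δ b x

IsResistance : (G : Graph) → (V G → V G → ℚ) → Set
IsResistance G ρ = ∀ a b → Σ (V G → ℚ) (λ y → IsPotential G a b y × ρ a b ≡ y a - y b)

potential-drop-unique : ∀ {G} → IsSimple G → Connected G → ∀ {a b y z} →
  IsPotential G a b y → IsPotential G a b z → y a - y b ≡ z a - z b
potential-drop-unique {G} simple connected {a} {b} {y} {z} y-pot z-pot = begin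
  y a - y b                                ≡⟨ solve 4 (λ ya yb za zb → ya :- yb := (ya :- za) :- (yb :- zb) :+ (za :- zb)) refl (y a) (y b) (z a) (z b) ⟩
  (y a - z a) - (y b - z b) + (z a - z b)  ≡⟨ cong (λ d → d - (y b - z b) + (z a - z b)) (harmonic⇒constant simple connected harmonic a b) ⟩
  (y b - z b) - (y b - z b) + (z a - z b)  ≡⟨ solve 3 (λ d za zb → d :- d :+ (za :- zb) := za :- zb) refl (y b - z b) (z a) (z b) ⟩
  z a - z b                                ∎
  where
  harmonic : ∀ x → laplace G (λ t → y t - z t) x ≡ 0ℚ
  harmonic x = trans (laplace-sub G y z x) (trans (cong₂ _-_ (y-pot x) (z-pot x)) (ℚ.+-inverseʳ (δ a x - δ b x)))

record IsNetwork (G : Graph) (ρ : V G → V G → ℚ) : Set where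
  field
    simple       : IsSimple G
    connected    : Connected G
    isResistance : IsResistance G ρ

resistance≡drop : ∀ {G ρ} → IsNetwork G ρ → ∀ {a b y} → IsPotential G a b y → ρ a b ≡ y a - y b
resistance≡drop N {a} {b} y-pot with IsNetwork.isResistance N a b
... | z , z-pot , ρ≡drop = trans ρ≡drop (potential-drop-unique (IsNetwork.simple N) (IsNetwork.connected N) z-pot y-pot)

resistance-refl : ∀ {G ρ} → IsResistance G ρ → ∀ a → ρ a a ≡ 0ℚ
resistance-refl R a with R a a
... | y , _ , ρ≡drop = trans ρ≡drop (ℚ.+-inverseʳ (y a))

resistance-sym : ∀ {G ρ} → IsNetwork G ρ → ∀ a b → ρ a b ≡ ρ b a
resistance-sym {G} N a b with IsNetwork.isResistance N a b
... | y , y-pot , ρ≡drop = trans ρ≡drop (sym (trans (resistance≡drop N reversed)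
        (solve 2 (λ p q → :- q :- :- p := p :- q) refl (y a) (y b))))
  where
  reversed : IsPotential G b a (λ t → - y t)
  reversed x = trans (laplace-neg G y x) (trans (cong -_ (y-pot x))
    (solve 2 (λ p q → :- (p :- q) := q :- p) refl (δ a x) (δ b x)))

network-unique : ∀ {G ρ ρ′} → IsNetwork G ρ → IsNetwork G ρ′ → ∀ a b → ρ a b ≡ ρ′ a b
network-unique N N′ a b with IsNetwork.isResistance N′ a b
... | y , y-pot , ρ′≡drop = trans (resistance≡drop N y-pot) (sym ρ′≡drop)

-- With P = L X and Q = I - P, the Penrose equations make each column of Q harmonic, hence constant;
-- as Q is symmetric, L (X e_a - X e_b) = P (e_a - e_b) = e_a - e_b.
pseudoinverse⇒resistance : ∀ {G} → IsSimple G → Connected G → ∀ {X} →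
  IsPseudoinverse (Laplacian G) X → IsResistance G (resistance G X)
pseudoinverse⇒resistance {G} simple connected {X} (LXL≡L , _ , LX-sym , _) a b =
  (λ t → X t a - X t b) , potential ,
  solve 4 (λ aa bb ab ba → (aa :+ bb) :+ :- (ab :+ ba) := (aa :- ab) :- (ba :- bb)) refl (X a a) (X b b) (X a b) (X b a)
  where
  L = Laplacian G
  P : V G → V G → ℚ
  P = L · X
  Q : V G → V G → ℚ
  Q i j = δ i j - P i j
  column-harmonic : ∀ j x → laplace G (λ t → Q t j) x ≡ 0ℚ
  column-harmonic j x = begin
    laplace G (λ t → Q t j) x                                 ≡⟨ laplace-sub G (λ t → δ t j) (λ t → P t j) x ⟩
    Σℚ (n G) (λ t → L x t * δ t j) - Σℚ (n G) (λ t → L x t * P t j)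
      ≡⟨ cong₂ _-_ (trans (Σℚ-cong (n G) (λ t → ℚ.*-comm (L x t) (δ t j))) (Σℚ-δʳ (n G) j (L x)))
                   (Σℚ-cong (n G) (λ t → trans (cong₂ _*_ (laplacian-sym simple x t) (LX-sym j t)) (ℚ.*-comm (L t x) (P j t)))) ⟩
    L x j - Σℚ (n G) (λ t → P j t * L t x)                    ≡⟨ cong (λ s → L x j - s) (trans (LXL≡L j x) (laplacian-sym simple j x)) ⟩
    L x j - L x j                                             ≡⟨ ℚ.+-inverseʳ (L x j) ⟩
    0ℚ                                                        ∎
  Q-diagonal : ∀ x a → Q x a ≡ Q x x
  Q-diagonal x a = trans (cong₂ _-_ (δ-sym x a) (sym (LX-sym x a))) (harmonic⇒constant simple connected (column-harmonic x) a x)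
  potential : IsPotential G a b (λ t → X t a - X t b)
  potential x = begin
    laplace G (λ t → X t a - X t b) x  ≡⟨ laplace-sub G (λ t → X t a) (λ t → X t b) x ⟩
    P x a - P x b                      ≡⟨ solve 4 (λ pa pb da db → pa :- pb := (da :- (da :- pa)) :- (db :- (db :- pb))) refl (P x a) (P x b) (δ x a) (δ x b) ⟩
    (δ x a - Q x a) - (δ x b - Q x b)  ≡⟨ cong₂ (λ u v → (δ x a - u) - (δ x b - v)) (Q-diagonal x a) (Q-diagonal x b) ⟩
    (δ x a - Q x x) - (δ x b - Q x x)  ≡⟨ [p-r]-[q-r]≡p-q (δ x a) (δ x b) (Q x x) ⟩
    δ x a - δ x b                      ≡⟨ cong₂ _-_ (δ-sym x a) (δ-sym x b) ⟩
    δ a x - δ b x                      ∎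

pseudoinverse⇒network : ∀ {G} → IsSimple G → Connected G → ∀ {X} →
  IsPseudoinverse (Laplacian G) X → IsNetwork G (resistance G X)
pseudoinverse⇒network simple connected pinv =
  record { simple = simple ; connected = connected ; isResistance = pseudoinverse⇒resistance simple connected pinv }

hub-potentials⇒resistance : ∀ {G} (h : V G) → (∀ x → Σ (V G → ℚ) (IsPotential G x h)) →
  Σ (V G → V G → ℚ) (IsResistance G)
hub-potentials⇒resistance {G} h toHub = (λ a b → drop a b a - drop a b b) , λ a b → drop a b , potential a b , refl
  where
  drop : V G → V G → V G → ℚ
  drop a b t = proj₁ (toHub a) t - proj₁ (toHub b) t
  potential : ∀ a b → IsPotential G a b (drop a b)
  potential a b x = trans (laplace-sub G _ _ x) (trans (cong₂ _-_ (proj₂ (toHub a) x) (proj₂ (toHub b) x))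
    ([p-r]-[q-r]≡p-q (δ a x) (δ b x) (δ h x)))

Σdeg : (G : Graph) → (V G → ℚ) → ℚ
Σdeg G f = Σℚ (n G) (λ x → ℕ→ℚ (deg G x) * f x)

vol : Graph → ℚ
vol G = Σℚ (n G) (λ x → ℕ→ℚ (deg G x))

-- With ρ = resistance G X, μ G ρ v is moment G X v and kemeny G X is inv (4 m) * kemenySum G ρ by definition.
μ : (G : Graph) → (V G → V G → ℚ) → V G → ℚ
μ G ρ v = Σdeg G (λ i → ρ i v)

kemenySum : (G : Graph) → (V G → V G → ℚ) → ℚ
kemenySum G ρ = Σℚ (n G) (λ i → Σℚ (n G) (λ j → (ℕ→ℚ (deg G i) * ℕ→ℚ (deg G j)) * ρ i j))

Σdeg-cong : ∀ G {f g : V G → ℚ} → (∀ x → f x ≡ g x) → Σdeg G f ≡ Σdeg G g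
Σdeg-cong G f≗g = Σℚ-cong (n G) (λ x → cong (ℕ→ℚ (deg G x) *_) (f≗g x))

Σdeg-+ : ∀ G (f g : V G → ℚ) → Σdeg G (λ x → f x + g x) ≡ Σdeg G f + Σdeg G g
Σdeg-+ G f g = trans (Σℚ-cong (n G) (λ x → ℚ.*-distribˡ-+ (ℕ→ℚ (deg G x)) (f x) (g x))) (Σℚ-+ (n G) _ _)

Σdeg-*ˡ : ∀ G c (f : V G → ℚ) → Σdeg G (λ x → c * f x) ≡ c * Σdeg G f
Σdeg-*ˡ G c f = trans (Σℚ-cong (n G) (λ x → solve 3 (λ d c y → d :* (c :* y) := c :* (d :* y)) refl (ℕ→ℚ (deg G x)) c (f x)))
                      (Σℚ-*ˡ (n G) c _)

Σdeg-const : ∀ G c → Σdeg G (λ _ → c) ≡ vol G * c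
Σdeg-const G c = Σℚ-*ʳ (n G) c _

kemenySum≡Σdeg² : ∀ G ρ → kemenySum G ρ ≡ Σdeg G (λ x → Σdeg G (ρ x))
kemenySum≡Σdeg² G ρ = Σℚ-cong (n G) (λ x →
  trans (Σℚ-cong (n G) (λ z → ℚ.*-assoc (ℕ→ℚ (deg G x)) (ℕ→ℚ (deg G z)) (ρ x z))) (Σℚ-*ˡ (n G) (ℕ→ℚ (deg G x)) _))

handshake : ∀ {G} → IsSimple G → vol G ≡ ℕ→ℚ 2 * ℕ→ℚ (edges G)
handshake {G} (symmetric , loopless) = begin
  Σℚ N (λ x → ℕ→ℚ (deg G x))                           ≡⟨ Σℚ-cong N (ℕ→ℚ-deg G) ⟩
  Σℚ N (λ x → Σℚ N (λ t → 𝟙 (adj G x t)))              ≡⟨ Σℚ-cong N (λ x → Σℚ-cong N (edge-split x)) ⟩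
  Σℚ N (λ x → Σℚ N (λ t → A x t + A t x))              ≡⟨ Σℚ-cong N (λ x → Σℚ-+ N (A x) (λ t → A t x)) ⟩
  Σℚ N (λ x → Σℚ N (A x) + Σℚ N (λ t → A t x))         ≡⟨ Σℚ-+ N _ _ ⟩
  E + Σℚ N (λ x → Σℚ N (λ t → A t x))                  ≡⟨ cong (E +_) (Σℚ-comm N N (λ x t → A t x)) ⟩
  E + E                                                ≡⟨ solve 1 (λ e → e :+ e := con (ℕ→ℚ 2) :* e) refl E ⟩
  ℕ→ℚ 2 * E                                            ≡⟨ cong (ℕ→ℚ 2 *_) edges≡E ⟨
  ℕ→ℚ 2 * ℕ→ℚ (edges G)                                ∎
  where
  N = n G
  A : V G → V G → ℚ
  A x t = 𝟙 ((toℕ x <ᵇ toℕ t) ∧ adj G x t)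
  E = Σℚ N (λ x → Σℚ N (A x))
  edges≡E : ℕ→ℚ (edges G) ≡ E
  edges≡E = trans (ℕ→ℚ-homo-Σ N _) (Σℚ-cong N (λ x →
    trans (ℕ→ℚ-homo-Σ N _) (Σℚ-cong N (λ t → ℕ→ℚ-indicator ((toℕ x <ᵇ toℕ t) ∧ adj G x t)))))
  -- each edge is counted once from its endpoint with the smaller index
  edge-split : ∀ x t → 𝟙 (adj G x t) ≡ A x t + A t x
  edge-split x t with toℕ x <ᵇ toℕ t | ℕ.<ᵇ-reflects-< (toℕ x) (toℕ t) | toℕ t <ᵇ toℕ x | ℕ.<ᵇ-reflects-< (toℕ t) (toℕ x)
  ... | true  | ofʸ x<t  | true  | ofʸ t<x = contradiction t<x (ℕ.<-asym x<t)
  ... | true  | _        | false | _       = sym (ℚ.+-identityʳ _)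
  ... | false | _        | true  | _       rewrite symmetric x t = sym (ℚ.+-identityˡ _)
  ... | false | ofⁿ x≮t  | false | ofⁿ t≮x rewrite toℕ-injective (ℕ.≤∧≮⇒≡ (ℕ.≮⇒≥ t≮x) x≮t) | loopless t = refl

-- 1-sums

↑ˡ≢↑ʳ : ∀ {m n} (i : Fin m) (j : Fin n) → i ↑ˡ n ≢ m ↑ʳ j
↑ˡ≢↑ʳ {m} {n} i j eq with trans (sym (splitAt-↑ˡ m i n)) (trans (cong (splitAt m) eq) (splitAt-↑ʳ m n j))
... | ()

_++ʷ_ : ∀ {G i j l} → Walk G i j → Walk G j l → Walk G i l
here       ++ʷ q = q
step i~j p ++ʷ q = step i~j (p ++ʷ q)

-- oneSum H u K w only computes once K is presented as mkGraph (suc k) adjK; its vertices are then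
-- a ↑ˡ k for a ∈ V H, and n H ↑ʳ s standing for the vertex punchIn w s of K.
module OneSum (H : Graph) (u : V H) (k : ℕ) (adjK : Fin (suc k) → Fin (suc k) → Bool) (w : Fin (suc k)) where

  K : Graph
  K = mkGraph (suc k) adjK

  G : Graph
  G = oneSum H u K w

  eK : V K → V G
  eK = embK H u K w

  data Side : V G → Set where
    inH : ∀ a → Side (a ↑ˡ k)
    inK : ∀ s → Side (n H ↑ʳ s)

  side : ∀ x → Side x
  side x = subst Side (join-splitAt (n H) k x) (fromSplit (splitAt (n H) x))
    where
    fromSplit : (z : V H ⊎ Fin k) → Side (join (n H) k z)
    fromSplit (inj₁ a) = inH a
    fromSplit (inj₂ s) = inK s

  data KVertex : V K → Set where
    glued : KVertex w
    other : ∀ s → KVertex (punchIn w s)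

  kVertex : ∀ c → KVertex c
  kVertex c with w ≟ c
  ... | yes refl = glued
  ... | no w≢c   = subst KVertex (punchIn-punchOut w≢c) (other (punchOut w≢c))

  eK-glued : eK w ≡ u ↑ˡ k
  eK-glued with w ≟ w
  ... | yes _   = refl
  ... | no w≢w  = ⊥-elim (w≢w refl)

  eK-other : ∀ s → eK (punchIn w s) ≡ n H ↑ʳ s
  eK-other s with w ≟ punchIn w s
  ... | yes w≡ws = ⊥-elim (punchInᵢ≢i w s (sym w≡ws))
  ... | no _     = cong (n H ↑ʳ_) (trans (punchOut-cong w refl) (punchOut-punchIn w))

  adj-HH : adjK w w ≡ false → ∀ a b → adj G (a ↑ˡ k) (b ↑ˡ k) ≡ adj H a b
  adj-HH w≁w a b rewrite splitAt-↑ˡ (n H) a k | splitAt-↑ˡ (n H) b k with a ≟ u | b ≟ u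
  ... | yes _ | yes _ rewrite w≁w = ∨-identityʳ (adj H a b)
  ... | yes _ | no _  = ∨-identityʳ (adj H a b)
  ... | no _  | yes _ = ∨-identityʳ (adj H a b)
  ... | no _  | no _  = ∨-identityʳ (adj H a b)

  adj-HK : ∀ a s → adj G (a ↑ˡ k) (n H ↑ʳ s) ≡ does (a ≟ u) ∧ adjK w (punchIn w s)
  adj-HK a s rewrite splitAt-↑ˡ (n H) a k | splitAt-↑ʳ (n H) k s with a ≟ u
  ... | yes _ = refl
  ... | no _  = refl

  adj-KH : ∀ s b → adj G (n H ↑ʳ s) (b ↑ˡ k) ≡ does (b ≟ u) ∧ adjK (punchIn w s) w
  adj-KH s b rewrite splitAt-↑ˡ (n H) b k | splitAt-↑ʳ (n H) k s with b ≟ u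
  ... | yes _ = refl
  ... | no _  = refl

  adj-KK : ∀ s t → adj G (n H ↑ʳ s) (n H ↑ʳ t) ≡ adjK (punchIn w s) (punchIn w t)
  adj-KK s t rewrite splitAt-↑ʳ (n H) k s | splitAt-↑ʳ (n H) k t = refl

  adj-eK : adjK w w ≡ false → ∀ c d → adjK c d ≡ true → adj G (eK c) (eK d) ≡ true
  adj-eK w≁w c d c~d with kVertex c | kVertex d
  ... | glued   | glued   = contradiction (trans (sym w≁w) c~d) λ ()
  ... | glued   | other t rewrite eK-glued | eK-other t | adj-HK u t with u ≟ u
  ...   | yes _   = c~d
  ...   | no u≢u  = ⊥-elim (u≢u refl)
  adj-eK w≁w c d c~d | other s | glued rewrite eK-glued | eK-other s | adj-KH s u with u ≟ u
  ...   | yes _   = c~d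
  ...   | no u≢u  = ⊥-elim (u≢u refl)
  adj-eK w≁w c d c~d | other s | other t rewrite eK-other s | eK-other t = trans (adj-KK s t) c~d

  simple : IsSimple H → IsSimple K → IsSimple G
  simple (symH , looplessH) (symK , looplessK) = symmetric , loopless
    where
    symmetric : ∀ x y → adj G x y ≡ adj G y x
    symmetric x y with side x | side y
    ... | inH a | inH b = trans (adj-HH (looplessK w) a b) (trans (symH a b) (sym (adj-HH (looplessK w) b a)))
    ... | inH a | inK s = trans (adj-HK a s) (trans (cong (does (a ≟ u) ∧_) (symK w (punchIn w s))) (sym (adj-KH s a)))
    ... | inK s | inH b = trans (adj-KH s b) (trans (cong (does (b ≟ u) ∧_) (symK (punchIn w s) w)) (sym (adj-HK b s)))
    ... | inK s | inK t = trans (adj-KK s t) (trans (symK (punchIn w s) (punchIn w t)) (sym (adj-KK t s)))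
    loopless : ∀ x → adj G x x ≡ false
    loopless x with side x
    ... | inH a = trans (adj-HH (looplessK w) a a) (looplessH a)
    ... | inK s = trans (adj-KK s s) (looplessK (punchIn w s))

  walk-H : adjK w w ≡ false → ∀ {a b} → Walk H a b → Walk G (a ↑ˡ k) (b ↑ˡ k)
  walk-H w≁w here = here
  walk-H w≁w (step {i} {j} i~j p) = step (trans (adj-HH w≁w i j) i~j) (walk-H w≁w p)

  walk-K : adjK w w ≡ false → ∀ {c d} → Walk K c d → Walk G (eK c) (eK d)
  walk-K w≁w here = here
  walk-K w≁w (step {i} {j} i~j p) = step (adj-eK w≁w i j i~j) (walk-K w≁w p)

  connected : IsSimple K → Connected H → Connected K → Connected G
  connected (_ , looplessK) connH connK x y = toHub x ++ʷ fromHub y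
    where
    w≁w = looplessK w
    toHub : ∀ x → Walk G x (u ↑ˡ k)
    toHub x with side x
    ... | inH a = walk-H w≁w (connH a u)
    ... | inK s = subst₂ (Walk G) (eK-other s) eK-glued (walk-K w≁w (connK (punchIn w s) w))
    fromHub : ∀ y → Walk G (u ↑ˡ k) y
    fromHub y with side y
    ... | inH a = walk-H w≁w (connH u a)
    ... | inK s = subst₂ (Walk G) eK-glued (eK-other s) (walk-K w≁w (connK w (punchIn w s)))

  Σ-drop-glued : adjK w w ≡ false → ∀ (h : V K → ℚ) →
    Σℚ (suc k) (λ c → 𝟙 (adjK w c) * h c) ≡ Σℚ k (λ s → 𝟙 (adjK w (punchIn w s)) * h (punchIn w s))
  Σ-drop-glued w≁w h = begin
    Σℚ (suc k) (λ c → 𝟙 (adjK w c) * h c)                                    ≡⟨ Σℚ-punchIn k w (λ c → 𝟙 (adjK w c) * h c) ⟩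
    𝟙 (adjK w w) * h w + Σℚ k (λ s → 𝟙 (adjK w (punchIn w s)) * h (punchIn w s))
      ≡⟨ cong (λ e → 𝟙 e * h w + Σℚ k (λ s → 𝟙 (adjK w (punchIn w s)) * h (punchIn w s))) w≁w ⟩
    0ℚ * h w + Σℚ k (λ s → 𝟙 (adjK w (punchIn w s)) * h (punchIn w s))
      ≡⟨ trans (cong (_+ Σℚ k (λ s → 𝟙 (adjK w (punchIn w s)) * h (punchIn w s))) (ℚ.*-zeroˡ (h w))) (ℚ.+-identityˡ _) ⟩
    Σℚ k (λ s → 𝟙 (adjK w (punchIn w s)) * h (punchIn w s))                  ∎

  Σ-neighbours-H : adjK w w ≡ false → ∀ a (g : V G → ℚ) →
    Σℚ (n G) (λ x → 𝟙 (adj G (a ↑ˡ k) x) * g x)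
      ≡ Σℚ (n H) (λ b → 𝟙 (adj H a b) * g (b ↑ˡ k)) + δ a u * Σℚ (suc k) (λ c → 𝟙 (adjK w c) * g (eK c))
  Σ-neighbours-H w≁w a g = begin
    Σℚ (n G) (λ x → 𝟙 (adj G (a ↑ˡ k) x) * g x)
      ≡⟨ Σℚ-↑ (n H) k _ ⟩
    Σℚ (n H) (λ b → 𝟙 (adj G (a ↑ˡ k) (b ↑ˡ k)) * g (b ↑ˡ k)) + Σℚ k (λ s → 𝟙 (adj G (a ↑ˡ k) (n H ↑ʳ s)) * g (n H ↑ʳ s))
      ≡⟨ cong₂ _+_ (Σℚ-cong (n H) (λ b → cong (λ e → 𝟙 e * g (b ↑ˡ k)) (adj-HH w≁w a b))) (Σℚ-cong k toK) ⟩
    Σℚ (n H) (λ b → 𝟙 (adj H a b) * g (b ↑ˡ k)) + Σℚ k (λ s → δ a u * (𝟙 (adjK w (punchIn w s)) * g (eK (punchIn w s))))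
      ≡⟨ cong (Σℚ (n H) (λ b → 𝟙 (adj H a b) * g (b ↑ˡ k)) +_)
              (trans (Σℚ-*ˡ k (δ a u) _) (cong (δ a u *_) (sym (Σ-drop-glued w≁w (λ c → g (eK c)))))) ⟩
    Σℚ (n H) (λ b → 𝟙 (adj H a b) * g (b ↑ˡ k)) + δ a u * Σℚ (suc k) (λ c → 𝟙 (adjK w c) * g (eK c)) ∎
    where
    toK : ∀ s → 𝟙 (adj G (a ↑ˡ k) (n H ↑ʳ s)) * g (n H ↑ʳ s) ≡ δ a u * (𝟙 (adjK w (punchIn w s)) * g (eK (punchIn w s)))
    toK s rewrite adj-HK a s | 𝟙-∧ (does (a ≟ u)) (adjK w (punchIn w s)) | eK-other s =
      ℚ.*-assoc (δ a u) _ (g (n H ↑ʳ s))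

  Σ-neighbours-K : ∀ s (g : V G → ℚ) →
    Σℚ (n G) (λ x → 𝟙 (adj G (n H ↑ʳ s) x) * g x) ≡ Σℚ (suc k) (λ c → 𝟙 (adjK (punchIn w s) c) * g (eK c))
  Σ-neighbours-K s g = begin
    Σℚ (n G) (λ x → 𝟙 (adj G (n H ↑ʳ s) x) * g x)
      ≡⟨ Σℚ-↑ (n H) k _ ⟩
    Σℚ (n H) (λ b → 𝟙 (adj G (n H ↑ʳ s) (b ↑ˡ k)) * g (b ↑ˡ k)) + Σℚ k (λ t → 𝟙 (adj G (n H ↑ʳ s) (n H ↑ʳ t)) * g (n H ↑ʳ t))
      ≡⟨ cong₂ _+_ (trans (Σℚ-cong (n H) toH) (Σℚ-δʳ (n H) u _)) (Σℚ-cong k toK) ⟩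
    𝟙 (adjK (punchIn w s) w) * g (u ↑ˡ k) + Σℚ k (λ t → 𝟙 (adjK (punchIn w s) (punchIn w t)) * g (eK (punchIn w t)))
      ≡⟨ cong (λ x → 𝟙 (adjK (punchIn w s) w) * g x + Σℚ k (λ t → 𝟙 (adjK (punchIn w s) (punchIn w t)) * g (eK (punchIn w t)))) eK-glued ⟨
    𝟙 (adjK (punchIn w s) w) * g (eK w) + Σℚ k (λ t → 𝟙 (adjK (punchIn w s) (punchIn w t)) * g (eK (punchIn w t)))
      ≡⟨ Σℚ-punchIn k w (λ c → 𝟙 (adjK (punchIn w s) c) * g (eK c)) ⟨
    Σℚ (suc k) (λ c → 𝟙 (adjK (punchIn w s) c) * g (eK c)) ∎
    where
    toH : ∀ b → 𝟙 (adj G (n H ↑ʳ s) (b ↑ˡ k)) * g (b ↑ˡ k) ≡ δ b u * (𝟙 (adjK (punchIn w s) w) * g (b ↑ˡ k))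
    toH b rewrite adj-KH s b | 𝟙-∧ (does (b ≟ u)) (adjK (punchIn w s) w) = ℚ.*-assoc (δ b u) _ (g (b ↑ˡ k))
    toK : ∀ t → 𝟙 (adj G (n H ↑ʳ s) (n H ↑ʳ t)) * g (n H ↑ʳ t) ≡ 𝟙 (adjK (punchIn w s) (punchIn w t)) * g (eK (punchIn w t))
    toK t rewrite adj-KK s t | eK-other t = refl

  deg-as-Σ-neighbours : ∀ Γ x → ℕ→ℚ (deg Γ x) ≡ Σℚ (n Γ) (λ t → 𝟙 (adj Γ x t) * 1ℚ)
  deg-as-Σ-neighbours Γ x = trans (ℕ→ℚ-deg Γ x) (Σℚ-cong (n Γ) (λ t → sym (ℚ.*-identityʳ _)))

  deg-H : adjK w w ≡ false → ∀ a → ℕ→ℚ (deg G (a ↑ˡ k)) ≡ ℕ→ℚ (deg H a) + δ a u * ℕ→ℚ (deg K w)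
  deg-H w≁w a = trans (deg-as-Σ-neighbours G (a ↑ˡ k)) (trans (Σ-neighbours-H w≁w a (λ _ → 1ℚ))
    (sym (cong₂ (λ d e → d + δ a u * e) (deg-as-Σ-neighbours H a) (deg-as-Σ-neighbours K w))))

  deg-K : ∀ s → ℕ→ℚ (deg G (n H ↑ʳ s)) ≡ ℕ→ℚ (deg K (punchIn w s))
  deg-K s = trans (deg-as-Σ-neighbours G (n H ↑ʳ s)) (trans (Σ-neighbours-K s (λ _ → 1ℚ)) (sym (deg-as-Σ-neighbours K (punchIn w s))))

  Σdeg-split : adjK w w ≡ false → ∀ (f : V G → ℚ) → Σdeg G f ≡ Σdeg H (λ a → f (a ↑ˡ k)) + Σdeg K (λ c → f (eK c))
  Σdeg-split w≁w f = begin
    Σdeg G f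
      ≡⟨ Σℚ-↑ (n H) k _ ⟩
    Σℚ (n H) (λ a → ℕ→ℚ (deg G (a ↑ˡ k)) * f (a ↑ˡ k)) + Σℚ k (λ s → ℕ→ℚ (deg G (n H ↑ʳ s)) * f (n H ↑ʳ s))
      ≡⟨ cong₂ _+_ (Σℚ-cong (n H) onH) (Σℚ-cong k (λ s → cong₂ _*_ (deg-K s) (cong f (sym (eK-other s))))) ⟩
    Σℚ (n H) (λ a → ℕ→ℚ (deg H a) * f (a ↑ˡ k) + δ a u * (dw * f (a ↑ˡ k))) + rest
      ≡⟨ cong (_+ rest) (Σℚ-+ (n H) _ _) ⟩
    (Σdeg H (λ a → f (a ↑ˡ k)) + Σℚ (n H) (λ a → δ a u * (dw * f (a ↑ˡ k)))) + rest
      ≡⟨ cong (λ z → (Σdeg H (λ a → f (a ↑ˡ k)) + z) + rest) (trans (Σℚ-δʳ (n H) u _) (cong (λ x → dw * f x) (sym eK-glued))) ⟩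
    (Σdeg H (λ a → f (a ↑ˡ k)) + dw * f (eK w)) + rest
      ≡⟨ ℚ.+-assoc (Σdeg H (λ a → f (a ↑ˡ k))) _ rest ⟩
    Σdeg H (λ a → f (a ↑ˡ k)) + (dw * f (eK w) + rest)
      ≡⟨ cong (Σdeg H (λ a → f (a ↑ˡ k)) +_) (Σℚ-punchIn k w (λ c → ℕ→ℚ (deg K c) * f (eK c))) ⟨
    Σdeg H (λ a → f (a ↑ˡ k)) + Σdeg K (λ c → f (eK c)) ∎
    where
    dw = ℕ→ℚ (deg K w)
    rest = Σℚ k (λ s → ℕ→ℚ (deg K (punchIn w s)) * f (eK (punchIn w s)))
    onH : ∀ a → ℕ→ℚ (deg G (a ↑ˡ k)) * f (a ↑ˡ k) ≡ ℕ→ℚ (deg H a) * f (a ↑ˡ k) + δ a u * (dw * f (a ↑ˡ k))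
    onH a = trans (cong (_* f (a ↑ˡ k)) (deg-H w≁w a))
      (solve 4 (λ d e D y → (d :+ e :* D) :* y := d :* y :+ e :* (D :* y)) refl (ℕ→ℚ (deg H a)) (δ a u) dw (f (a ↑ˡ k)))

  -- Shifted to vanish at the cut vertex, potentials on H and K agree there and glue to one on G.
  joined : (V H → ℚ) → (V K → ℚ) → V G → ℚ
  joined yH yK x = [ (λ a → yH a - yH u) , (λ s → yK (punchIn w s) - yK w) ]′ (splitAt (n H) x)

  joined-H : ∀ yH yK a → joined yH yK (a ↑ˡ k) ≡ yH a - yH u
  joined-H yH yK a rewrite splitAt-↑ˡ (n H) a k = refl

  joined-K : ∀ yH yK c → joined yH yK (eK c) ≡ yK c - yK w
  joined-K yH yK c with kVertex c
  ... | glued   rewrite eK-glued = trans (joined-H yH yK u) (trans (ℚ.+-inverseʳ (yH u)) (sym (ℚ.+-inverseʳ (yK w))))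
  ... | other s rewrite eK-other s | splitAt-↑ʳ (n H) k s = refl

  laplace-joined-H : IsSimple H → IsSimple K → ∀ yH yK a →
    laplace G (joined yH yK) (a ↑ˡ k) ≡ laplace H yH a + δ a u * laplace K yK w
  laplace-joined-H simpleH simpleK yH yK a = begin
    laplace G Y (a ↑ˡ k)
      ≡⟨ laplace-adjacency (simple simpleH simpleK) Y (a ↑ˡ k) ⟩
    Σℚ (n G) (λ x → 𝟙 (adj G (a ↑ˡ k) x) * (Y (a ↑ˡ k) - Y x))
      ≡⟨ Σ-neighbours-H (proj₂ simpleK w) a (λ x → Y (a ↑ˡ k) - Y x) ⟩
    Σℚ (n H) (λ b → 𝟙 (adj H a b) * (Y (a ↑ˡ k) - Y (b ↑ˡ k))) + δ a u * toK a
      ≡⟨ cong₂ _+_ (Σℚ-cong (n H) onH) (δ*-subst a u toK) ⟩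
    Σℚ (n H) (λ b → 𝟙 (adj H a b) * (yH a - yH b)) + δ a u * toK u
      ≡⟨ cong₂ (λ l r → l + δ a u * r) (sym (laplace-adjacency simpleH yH a))
               (trans (Σℚ-cong (suc k) onK) (sym (laplace-adjacency simpleK yK w))) ⟩
    laplace H yH a + δ a u * laplace K yK w ∎
    where
    Y = joined yH yK
    toK : V H → ℚ
    toK a′ = Σℚ (suc k) (λ c → 𝟙 (adjK w c) * (Y (a′ ↑ˡ k) - Y (eK c)))
    onH : ∀ b → 𝟙 (adj H a b) * (Y (a ↑ˡ k) - Y (b ↑ˡ k)) ≡ 𝟙 (adj H a b) * (yH a - yH b)
    onH b rewrite joined-H yH yK a | joined-H yH yK b =
      cong (𝟙 (adj H a b) *_) ([p-r]-[q-r]≡p-q (yH a) (yH b) (yH u))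
    onK : ∀ c → 𝟙 (adjK w c) * (Y (u ↑ˡ k) - Y (eK c)) ≡ 𝟙 (adjK w c) * (yK w - yK c)
    onK c rewrite joined-H yH yK u | joined-K yH yK c =
      cong (𝟙 (adjK w c) *_) ([p-p]-[q-r]≡r-q (yH u) (yK c) (yK w))

  laplace-joined-K : IsSimple H → IsSimple K → ∀ yH yK s →
    laplace G (joined yH yK) (n H ↑ʳ s) ≡ laplace K yK (punchIn w s)
  laplace-joined-K simpleH simpleK yH yK s = begin
    laplace G Y (n H ↑ʳ s)
      ≡⟨ laplace-adjacency (simple simpleH simpleK) Y (n H ↑ʳ s) ⟩
    Σℚ (n G) (λ x → 𝟙 (adj G (n H ↑ʳ s) x) * (Y (n H ↑ʳ s) - Y x))
      ≡⟨ Σ-neighbours-K s (λ x → Y (n H ↑ʳ s) - Y x) ⟩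
    Σℚ (suc k) (λ c → 𝟙 (adjK (punchIn w s) c) * (Y (n H ↑ʳ s) - Y (eK c)))
      ≡⟨ Σℚ-cong (suc k) onK ⟩
    Σℚ (suc k) (λ c → 𝟙 (adjK (punchIn w s) c) * (yK (punchIn w s) - yK c))
      ≡⟨ laplace-adjacency simpleK yK (punchIn w s) ⟨
    laplace K yK (punchIn w s) ∎
    where
    Y = joined yH yK
    onK : ∀ c → 𝟙 (adjK (punchIn w s) c) * (Y (n H ↑ʳ s) - Y (eK c)) ≡ 𝟙 (adjK (punchIn w s) c) * (yK (punchIn w s) - yK c)
    onK c rewrite sym (eK-other s) | joined-K yH yK (punchIn w s) | joined-K yH yK c =
      cong (𝟙 (adjK (punchIn w s) c) *_) ([p-r]-[q-r]≡p-q (yK (punchIn w s)) (yK c) (yK w))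

  δ-HH : ∀ (a b : V H) → δ (a ↑ˡ k) (b ↑ˡ k) ≡ δ a b
  δ-HH = δ-injective (↑ˡ-injective k)

  δ-HK : ∀ a s → δ (a ↑ˡ k) (n H ↑ʳ s) ≡ 0ℚ
  δ-HK a s = δ-≢ (↑ˡ≢↑ʳ a s)

  δ-eK-H : ∀ d b → δ (eK d) (b ↑ˡ k) ≡ δ b u * δ d w
  δ-eK-H d b with kVertex d
  ... | glued   rewrite eK-glued | δ-refl w = trans (δ-HH u b) (trans (δ-sym u b) (sym (ℚ.*-identityʳ (δ b u))))
  ... | other s rewrite eK-other s | δ-≢ (punchInᵢ≢i w s) =
    trans (δ-≢ (λ eq → ↑ˡ≢↑ʳ b s (sym eq))) (sym (ℚ.*-zeroʳ (δ b u)))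

  δ-eK-K : ∀ d t → δ (eK d) (n H ↑ʳ t) ≡ δ d (punchIn w t)
  δ-eK-K d t with kVertex d
  ... | glued   rewrite eK-glued = trans (δ-HK u t) (sym (δ-≢ (λ eq → punchInᵢ≢i w t (sym eq))))
  ... | other s rewrite eK-other s = trans (δ-injective (↑ʳ-injective (n H)) s t) (sym (δ-injective (punchIn-injective w) s t))

  joined-potential : IsSimple H → IsSimple K → ∀ a c d b yH yK → IsPotential H a c yH → IsPotential K d b yK →
    ∀ x → laplace G (joined yH yK) x ≡ (δ (a ↑ˡ k) x - δ (c ↑ˡ k) x) + (δ (eK d) x - δ (eK b) x)
  joined-potential simpleH simpleK a c d b yH yK potH potK x = onSide (side x)
    where
    onSide : ∀ {x} → Side x → laplace G (joined yH yK) x ≡ (δ (a ↑ˡ k) x - δ (c ↑ˡ k) x) + (δ (eK d) x - δ (eK b) x)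
    onSide (inH a′) = begin
      laplace G (joined yH yK) (a′ ↑ˡ k)                        ≡⟨ laplace-joined-H simpleH simpleK yH yK a′ ⟩
      laplace H yH a′ + δ a′ u * laplace K yK w                 ≡⟨ cong₂ (λ l r → l + δ a′ u * r) (potH a′) (potK w) ⟩
      (δ a a′ - δ c a′) + δ a′ u * (δ d w - δ b w)
        ≡⟨ cong ((δ a a′ - δ c a′) +_) (x[y-z]≈xy-xz (δ a′ u) (δ d w) (δ b w)) ⟩
      (δ a a′ - δ c a′) + (δ a′ u * δ d w - δ a′ u * δ b w)
        ≡⟨ cong₂ _+_ (cong₂ _-_ (δ-HH a a′) (δ-HH c a′)) (cong₂ _-_ (δ-eK-H d a′) (δ-eK-H b a′)) ⟨
      (δ (a ↑ˡ k) (a′ ↑ˡ k) - δ (c ↑ˡ k) (a′ ↑ˡ k)) + (δ (eK d) (a′ ↑ˡ k) - δ (eK b) (a′ ↑ˡ k)) ∎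
    onSide (inK s) = begin
      laplace G (joined yH yK) (n H ↑ʳ s)                        ≡⟨ laplace-joined-K simpleH simpleK yH yK s ⟩
      laplace K yK (punchIn w s)                                 ≡⟨ potK (punchIn w s) ⟩
      δ d (punchIn w s) - δ b (punchIn w s)                      ≡⟨ ℚ.+-identityˡ _ ⟨
      (0ℚ - 0ℚ) + (δ d (punchIn w s) - δ b (punchIn w s))
        ≡⟨ cong₂ _+_ (cong₂ _-_ (δ-HK a s) (δ-HK c s)) (cong₂ _-_ (δ-eK-K d s) (δ-eK-K b s)) ⟨
      (δ (a ↑ˡ k) (n H ↑ʳ s) - δ (c ↑ˡ k) (n H ↑ʳ s)) + (δ (eK d) (n H ↑ʳ s) - δ (eK b) (n H ↑ʳ s)) ∎

  module Resistance {ρH : V H → V H → ℚ} {ρK : V K → V K → ℚ} (NH : IsNetwork H ρH) (NK : IsNetwork K ρK) where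

    open IsNetwork NH using () renaming (simple to simpleH; connected to connH; isResistance to RH)
    open IsNetwork NK using () renaming (simple to simpleK; connected to connK; isResistance to RK)

    joinedPotential : V H → V H → V K → V K → V G → ℚ
    joinedPotential a c d b = joined (proj₁ (RH a c)) (proj₁ (RK d b))

    laplace-joinedPotential : ∀ a c d b t →
      laplace G (joinedPotential a c d b) t ≡ (δ (a ↑ˡ k) t - δ (c ↑ˡ k) t) + (δ (eK d) t - δ (eK b) t)
    laplace-joinedPotential a c d b =
      joined-potential simpleH simpleK a c d b (proj₁ (RH a c)) (proj₁ (RK d b)) (proj₁ (proj₂ (RH a c))) (proj₁ (proj₂ (RK d b)))

    joined-drop : ∀ {ρ} → IsNetwork G ρ → ∀ a c d b {x z} →
      (∀ t → (δ (a ↑ˡ k) t - δ (c ↑ˡ k) t) + (δ (eK d) t - δ (eK b) t) ≡ δ x t - δ z t) →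
      ρ x z ≡ joinedPotential a c d b x - joinedPotential a c d b z
    joined-drop NG a c d b sources =
      resistance≡drop NG {y = joinedPotential a c d b} (λ t → trans (laplace-joinedPotential a c d b t) (sources t))

    resistance-HH : ∀ {ρ} → IsNetwork G ρ → ∀ a b → ρ (a ↑ˡ k) (b ↑ˡ k) ≡ ρH a b
    resistance-HH {ρ} NG a b = let yH , _ , ρH≡drop = RH a b; yK = proj₁ (RK w w) in begin
      ρ (a ↑ˡ k) (b ↑ˡ k)
        ≡⟨ joined-drop NG a b w w (λ t → [p-q]+[r-r]≡p-q (δ (a ↑ˡ k) t) (δ (b ↑ˡ k) t) (δ (eK w) t)) ⟩
      joined yH yK (a ↑ˡ k) - joined yH yK (b ↑ˡ k)  ≡⟨ cong₂ _-_ (joined-H yH yK a) (joined-H yH yK b) ⟩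
      (yH a - yH u) - (yH b - yH u)                  ≡⟨ [p-r]-[q-r]≡p-q (yH a) (yH b) (yH u) ⟩
      yH a - yH b                                    ≡⟨ ρH≡drop ⟨
      ρH a b                                         ∎

    resistance-KK : ∀ {ρ} → IsNetwork G ρ → ∀ c d → ρ (eK c) (eK d) ≡ ρK c d
    resistance-KK {ρ} NG c d = let yH = proj₁ (RH u u); yK , _ , ρK≡drop = RK c d in begin
      ρ (eK c) (eK d)
        ≡⟨ joined-drop NG u u c d (λ t → [p-p]+[q-r]≡q-r (δ (u ↑ˡ k) t) (δ (eK c) t) (δ (eK d) t)) ⟩
      joined yH yK (eK c) - joined yH yK (eK d)      ≡⟨ cong₂ _-_ (joined-K yH yK c) (joined-K yH yK d) ⟩
      (yK c - yK w) - (yK d - yK w)                  ≡⟨ [p-r]-[q-r]≡p-q (yK c) (yK d) (yK w) ⟩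
      yK c - yK d                                    ≡⟨ ρK≡drop ⟨
      ρK c d                                         ∎

    resistance-HK : ∀ {ρ} → IsNetwork G ρ → ∀ a c → ρ (a ↑ˡ k) (eK c) ≡ ρH a u + ρK w c
    resistance-HK {ρ} NG a c = let yH , _ , ρH≡drop = RH a u; yK , _ , ρK≡drop = RK w c in begin
      ρ (a ↑ˡ k) (eK c)
        ≡⟨ joined-drop NG a u w c (λ t → trans (cong (λ v → (δ (a ↑ˡ k) t - δ (u ↑ˡ k) t) + (δ v t - δ (eK c) t)) eK-glued)
                                                ([p-q]+[q-r]≡p-r (δ (a ↑ˡ k) t) (δ (u ↑ˡ k) t) (δ (eK c) t))) ⟩
      joined yH yK (a ↑ˡ k) - joined yH yK (eK c)    ≡⟨ cong₂ _-_ (joined-H yH yK a) (joined-K yH yK c) ⟩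
      (yH a - yH u) - (yK c - yK w)                  ≡⟨ [p-q]-[r-s]≡[p-q]+[s-r] (yH a) (yH u) (yK c) (yK w) ⟩
      (yH a - yH u) + (yK w - yK c)                  ≡⟨ cong₂ _+_ ρH≡drop ρK≡drop ⟨
      ρH a u + ρK w c                                ∎

    toHub : ∀ {x} → Side x → Σ (V G → ℚ) (IsPotential G x (u ↑ˡ k))
    toHub (inH a) = joinedPotential a u w w , λ t → trans (laplace-joinedPotential a u w w t)
      ([p-q]+[r-r]≡p-q (δ (a ↑ˡ k) t) (δ (u ↑ˡ k) t) (δ (eK w) t))
    toHub (inK s) = joinedPotential u u (punchIn w s) w , λ t → trans (laplace-joinedPotential u u (punchIn w s) w t)
      (trans (cong₂ (λ p q → (δ (u ↑ˡ k) t - δ (u ↑ˡ k) t) + (δ p t - δ q t)) (eK-other s) eK-glued)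
             ([p-p]+[q-r]≡q-r (δ (u ↑ˡ k) t) (δ (n H ↑ʳ s) t) (δ (u ↑ˡ k) t)))

    network : Σ (V G → V G → ℚ) (IsNetwork G)
    network = let ρ , R = hub-potentials⇒resistance (u ↑ˡ k) (λ x → toHub (side x)) in
      ρ , record { simple = simple simpleH simpleK ; connected = connected simpleK connH connK ; isResistance = R }

module _ {H : Graph} {u : V H} where

  oneSum-simple : ∀ {K w} → IsSimple H → IsSimple K → IsSimple (oneSum H u K w)
  oneSum-simple {mkGraph zero _}         {()}
  oneSum-simple {mkGraph (suc k) adjK}   {w} = OneSum.simple H u k adjK w

  oneSum-Σdeg : ∀ {K w} → IsSimple K → ∀ f →
    Σdeg (oneSum H u K w) f ≡ Σdeg H (λ a → f (embH H u K w a)) + Σdeg K (λ c → f (embK H u K w c))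
  oneSum-Σdeg {mkGraph zero _}       {()}
  oneSum-Σdeg {mkGraph (suc k) adjK} {w} (_ , loopless) = OneSum.Σdeg-split H u k adjK w (loopless w)

  oneSum-network : ∀ {K w ρH ρK} → IsNetwork H ρH → IsNetwork K ρK → Σ (V (oneSum H u K w) → V (oneSum H u K w) → ℚ) (IsNetwork (oneSum H u K w))
  oneSum-network {mkGraph zero _}       {()}
  oneSum-network {mkGraph (suc k) adjK} {w} = OneSum.Resistance.network H u k adjK w

  oneSum-resistance-HH : ∀ {K w ρH ρK ρ} → IsNetwork H ρH → IsNetwork K ρK → IsNetwork (oneSum H u K w) ρ →
    ∀ a b → ρ (embH H u K w a) (embH H u K w b) ≡ ρH a b
  oneSum-resistance-HH {mkGraph zero _}       {()}
  oneSum-resistance-HH {mkGraph (suc k) adjK} {w} NH NK = OneSum.Resistance.resistance-HH H u k adjK w NH NK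

  oneSum-resistance-KK : ∀ {K w ρH ρK ρ} → IsNetwork H ρH → IsNetwork K ρK → IsNetwork (oneSum H u K w) ρ →
    ∀ c d → ρ (embK H u K w c) (embK H u K w d) ≡ ρK c d
  oneSum-resistance-KK {mkGraph zero _}       {()}
  oneSum-resistance-KK {mkGraph (suc k) adjK} {w} NH NK = OneSum.Resistance.resistance-KK H u k adjK w NH NK

  oneSum-resistance-HK : ∀ {K w ρH ρK ρ} → IsNetwork H ρH → IsNetwork K ρK → IsNetwork (oneSum H u K w) ρ →
    ∀ a c → ρ (embH H u K w a) (embK H u K w c) ≡ ρH a u + ρK w c
  oneSum-resistance-HK {mkGraph zero _}       {()}
  oneSum-resistance-HK {mkGraph (suc k) adjK} {w} NH NK = OneSum.Resistance.resistance-HK H u k adjK w NH NK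

-- The Kemeny sum of a 1-sum: each cross pair (a, c) contributes d_a d_c (r_H(a,u) + r_K(w,c)).
oneSum-kemenySum : ∀ {H u K w ρH ρK ρ} → IsNetwork H ρH → IsNetwork K ρK → IsNetwork (oneSum H u K w) ρ →
  kemenySum (oneSum H u K w) ρ ≡ (kemenySum H ρH + kemenySum K ρK) + ℕ→ℚ 2 * (vol K * μ H ρH u + vol H * μ K ρK w)
oneSum-kemenySum {H} {u} {K} {w} {ρH} {ρK} {ρ} NH NK NG = begin
  kemenySum G ρ
    ≡⟨ kemenySum≡Σdeg² G ρ ⟩
  Σdeg G (λ x → Σdeg G (ρ x))
    ≡⟨ split _ ⟩
  Σdeg H (λ a → Σdeg G (ρ (eH a))) + Σdeg K (λ c → Σdeg G (ρ (eK c)))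
    ≡⟨ cong₂ _+_ (Σdeg-cong H fromH) (Σdeg-cong K fromK) ⟩
  Σdeg H (λ a → Σdeg H (ρH a) + (vol K * ρH a u + μK)) + Σdeg K (λ c → (μH + vol H * ρK c w) + Σdeg K (ρK c))
    ≡⟨ cong₂ _+_ (trans (Σdeg-+ H _ _) (cong₂ _+_ (sym (kemenySum≡Σdeg² H ρH)) (trans (Σdeg-+ H _ _) (cong₂ _+_ (Σdeg-*ˡ H (vol K) _) (Σdeg-const H μK)))))
                 (trans (Σdeg-+ K _ _) (cong₂ _+_ (trans (Σdeg-+ K _ _) (cong₂ _+_ (Σdeg-const K μH) (Σdeg-*ˡ K (vol H) _))) (sym (kemenySum≡Σdeg² K ρK)))) ⟩
  (kemenySum H ρH + (vol K * μH + vol H * μK)) + ((vol K * μH + vol H * μK) + kemenySum K ρK)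
    ≡⟨ solve 6 (λ sH sK DK DH mH mK → (sH :+ (DK :* mH :+ DH :* mK)) :+ ((DK :* mH :+ DH :* mK) :+ sK)
                                     := (sH :+ sK) :+ con (ℕ→ℚ 2) :* (DK :* mH :+ DH :* mK))
             refl (kemenySum H ρH) (kemenySum K ρK) (vol K) (vol H) μH μK ⟩
  (kemenySum H ρH + kemenySum K ρK) + ℕ→ℚ 2 * (vol K * μH + vol H * μK) ∎
  where
  G = oneSum H u K w
  eH = embH H u K w
  eK = embK H u K w
  μH = μ H ρH u
  μK = μ K ρK w
  split : ∀ f → Σdeg G f ≡ Σdeg H (λ a → f (eH a)) + Σdeg K (λ c → f (eK c))
  split = oneSum-Σdeg (IsNetwork.simple NK)
  fromH : ∀ a → Σdeg G (ρ (eH a)) ≡ Σdeg H (ρH a) + (vol K * ρH a u + μK)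
  fromH a = begin
    Σdeg G (ρ (eH a))                                   ≡⟨ split _ ⟩
    Σdeg H (λ b → ρ (eH a) (eH b)) + Σdeg K (λ c → ρ (eH a) (eK c))
      ≡⟨ cong₂ _+_ (Σdeg-cong H (oneSum-resistance-HH NH NK NG a)) (Σdeg-cong K (oneSum-resistance-HK NH NK NG a)) ⟩
    Σdeg H (ρH a) + Σdeg K (λ c → ρH a u + ρK w c)
      ≡⟨ cong (Σdeg H (ρH a) +_) (trans (Σdeg-+ K _ _) (cong₂ _+_ (Σdeg-const K (ρH a u)) (Σdeg-cong K (resistance-sym NK w)))) ⟩
    Σdeg H (ρH a) + (vol K * ρH a u + μK)               ∎
  fromK : ∀ c → Σdeg G (ρ (eK c)) ≡ (μH + vol H * ρK c w) + Σdeg K (ρK c)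
  fromK c = begin
    Σdeg G (ρ (eK c))                                   ≡⟨ split _ ⟩
    Σdeg H (λ a → ρ (eK c) (eH a)) + Σdeg K (λ d → ρ (eK c) (eK d))
      ≡⟨ cong₂ _+_ (Σdeg-cong H (λ a → trans (resistance-sym NG (eK c) (eH a)) (oneSum-resistance-HK NH NK NG a c)))
                   (Σdeg-cong K (oneSum-resistance-KK NH NK NG c)) ⟩
    Σdeg H (λ a → ρH a u + ρK w c) + Σdeg K (ρK c)
      ≡⟨ cong (_+ Σdeg K (ρK c)) (trans (Σdeg-+ H (λ a → ρH a u) (λ _ → ρK w c)) (cong (μH +_) (trans (Σdeg-const H (ρK w c)) (cong (vol H *_) (resistance-sym NK w c))))) ⟩
    (μH + vol H * ρK c w) + Σdeg K (ρK c)               ∎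

-- Chains of 1-sums

ifNo : ∀ {P : Set} → Dec P → (¬ P → ℚ) → ℚ
ifNo (yes _) f = 0ℚ
ifNo (no ¬p) f = f ¬p

-- Abstracting the decisions i ≟_ gives a name to the summand hidden in the definition of Σ≠.
Σ≠-ifNo : ∀ {m} (i : Fin m) (f : (j : Fin m) → i ≢ j → ℚ) → Σ≠ i f ≡ Σℚ m (λ j → ifNo (i ≟ j) (f j))
Σ≠-ifNo {m} i f = trans unfold (Σℚ-cong m pointwise)
  where
  summand : (∀ j → Dec (i ≡ j)) → Fin m → ℚ
  summand = _
  unfold : Σ≠ i f ≡ Σℚ m (summand (i ≟_))
  unfold with i ≟_
  ... | _ = refl
  pointwise : ∀ j → summand (i ≟_) j ≡ ifNo (i ≟ j) (f j)
  pointwise j with i ≟ j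
  ... | yes _ = refl
  ... | no _  = refl

Resistances : (k : ℕ) → (Fin (suc k) → Graph) → Set
Resistances k Gs = (i : Fin (suc k)) → V (Gs i) → V (Gs i) → ℚ

module Tail {k : ℕ} (Gs : Fin (suc (suc k)) → Graph) (rv : RV (suc k) Gs) (lv : LV (suc k) Gs) where

  Gs′ : Fin (suc k) → Graph
  Gs′ i = Gs (suc i)

  rv′ : RV k Gs′
  rv′ t = rv (suc t)

  lv′ : LV k Gs′
  lv′ t = lv (suc t)

  C′ : Graph
  C′ = chainSum k Gs′ rv′ lv′

  emb′ : (i : Fin (suc k)) → V (Gs′ i) → V C′
  emb′ = emb k Gs′ rv′ lv′

  glue′ : Fin k → V C′
  glue′ = glue k Gs′ rv′ lv′

  link : V C′
  link = emb′ zero (lv zero)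

chain-simple : ∀ k Gs (rv : RV k Gs) (lv : LV k Gs) → (∀ i → IsSimple (Gs i)) → IsSimple (chainSum k Gs rv lv)
chain-simple zero    Gs rv lv simple = simple zero
chain-simple (suc k) Gs rv lv simple =
  oneSum-simple (simple zero) (chain-simple k Gs′ rv′ lv′ (λ i → simple (suc i)))
  where open Tail Gs rv lv

chain-network : ∀ k Gs (rv : RV k Gs) (lv : LV k Gs) (ρs : Resistances k Gs) → (∀ i → IsNetwork (Gs i) (ρs i)) →
  Σ (V (chainSum k Gs rv lv) → V (chainSum k Gs rv lv) → ℚ) (IsNetwork (chainSum k Gs rv lv))
chain-network zero    Gs rv lv ρs Ns = ρs zero , Ns zero
chain-network (suc k) Gs rv lv ρs Ns =
  oneSum-network (Ns zero) (proj₂ (chain-network k Gs′ rv′ lv′ (λ i → ρs (suc i)) (λ i → Ns (suc i))))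
  where open Tail Gs rv lv

chain-Σdeg : ∀ k Gs (rv : RV k Gs) (lv : LV k Gs) → (∀ i → IsSimple (Gs i)) → ∀ f →
  Σdeg (chainSum k Gs rv lv) f ≡ Σℚ (suc k) (λ i → Σdeg (Gs i) (λ a → f (emb k Gs rv lv i a)))
chain-Σdeg zero    Gs rv lv simple f = sym (ℚ.+-identityʳ _)
chain-Σdeg (suc k) Gs rv lv simple f =
  trans (oneSum-Σdeg (chain-simple k Gs′ rv′ lv′ (λ i → simple (suc i))) f)
        (cong (Σdeg (Gs zero) (λ a → f (emb (suc k) Gs rv lv zero a)) +_) (chain-Σdeg k Gs′ rv′ lv′ (λ i → simple (suc i)) _))
  where open Tail Gs rv lv

chain-vol : ∀ k Gs (rv : RV k Gs) (lv : LV k Gs) → (∀ i → IsSimple (Gs i)) →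
  vol (chainSum k Gs rv lv) ≡ Σℚ (suc k) (λ i → vol (Gs i))
chain-vol k Gs rv lv simple = begin
  vol C                                          ≡⟨ volume C ⟩
  Σdeg C (λ _ → 1ℚ)                              ≡⟨ chain-Σdeg k Gs rv lv simple (λ _ → 1ℚ) ⟩
  Σℚ (suc k) (λ i → Σdeg (Gs i) (λ _ → 1ℚ))      ≡⟨ Σℚ-cong (suc k) (λ i → volume (Gs i)) ⟨
  Σℚ (suc k) (λ i → vol (Gs i))                  ∎
  where
  C = chainSum k Gs rv lv
  volume : ∀ G → vol G ≡ Σdeg G (λ _ → 1ℚ)
  volume G = sym (trans (Σdeg-const G 1ℚ) (ℚ.*-identityʳ (vol G)))

module TailNetwork {k : ℕ} (Gs : Fin (suc (suc k)) → Graph) (rv : RV (suc k) Gs) (lv : LV (suc k) Gs)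
                   (ρs : Resistances (suc k) Gs) (Ns : ∀ i → IsNetwork (Gs i) (ρs i)) where

  open Tail Gs rv lv public

  ρs′ : Resistances k Gs′
  ρs′ i = ρs (suc i)

  Ns′ : ∀ i → IsNetwork (Gs′ i) (ρs′ i)
  Ns′ i = Ns (suc i)

  ρ′ : V C′ → V C′ → ℚ
  ρ′ = proj₁ (chain-network k Gs′ rv′ lv′ ρs′ Ns′)

  N′ : IsNetwork C′ ρ′
  N′ = proj₂ (chain-network k Gs′ rv′ lv′ ρs′ Ns′)

chain-resistance-within : ∀ k Gs (rv : RV k Gs) (lv : LV k Gs) (ρs : Resistances k Gs) (Ns : ∀ i → IsNetwork (Gs i) (ρs i)) →
  ∀ {ρ} → IsNetwork (chainSum k Gs rv lv) ρ → ∀ i a b → ρ (emb k Gs rv lv i a) (emb k Gs rv lv i b) ≡ ρs i a b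
chain-resistance-within zero    Gs rv lv ρs Ns NC zero    a b = network-unique NC (Ns zero) a b
chain-resistance-within (suc k) Gs rv lv ρs Ns NC zero    a b = oneSum-resistance-HH (Ns zero) N′ NC a b
  where open TailNetwork Gs rv lv ρs Ns
chain-resistance-within (suc k) Gs rv lv ρs Ns NC (suc i) a b =
  trans (oneSum-resistance-KK (Ns zero) N′ NC (emb′ i a) (emb′ i b)) (chain-resistance-within k Gs′ rv′ lv′ ρs′ Ns′ N′ i a b)
  where open TailNetwork Gs rv lv ρs Ns

chain-cut : ∀ k Gs (rv : RV k Gs) (lv : LV k Gs) (ρs : Resistances k Gs) (Ns : ∀ i → IsNetwork (Gs i) (ρs i)) →
  ∀ {ρ} → IsNetwork (chainSum k Gs rv lv) ρ → ∀ j b x →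
  ρ (emb k Gs rv lv (suc j) b) (emb k Gs rv lv zero x) ≡ ρs (suc j) b (lv j) + ρ (glue k Gs rv lv j) (emb k Gs rv lv zero x)
chain-cut (suc k) Gs rv lv ρs Ns {ρ} NC j b x = cut j b
  where
  open TailNetwork Gs rv lv ρs Ns
  eH = embH (Gs zero) (rv zero) C′ link
  eK = embK (Gs zero) (rv zero) C′ link
  across : ∀ c → ρ (eK c) (eH x) ≡ ρs zero x (rv zero) + ρ′ link c
  across c = trans (resistance-sym NC (eK c) (eH x)) (oneSum-resistance-HK (Ns zero) N′ NC x c)
  cut : ∀ j b → ρ (eK (emb′ j b)) (eH x) ≡ ρs (suc j) b (lv j) + ρ (glue (suc k) Gs rv lv j) (eH x)
  cut zero b = begin
    ρ (eK (emb′ zero b)) (eH x)                          ≡⟨ across _ ⟩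
    ρs zero x (rv zero) + ρ′ link (emb′ zero b)           ≡⟨ cong (ρs zero x (rv zero) +_) (chain-resistance-within k Gs′ rv′ lv′ ρs′ Ns′ N′ zero (lv zero) b) ⟩
    ρs zero x (rv zero) + ρs (suc zero) (lv zero) b
      ≡⟨ cong₂ _+_ (resistance-sym (Ns zero) x (rv zero)) (resistance-sym (Ns (suc zero)) (lv zero) b) ⟩
    ρs zero (rv zero) x + ρs (suc zero) b (lv zero)       ≡⟨ ℚ.+-comm (ρs zero (rv zero) x) _ ⟩
    ρs (suc zero) b (lv zero) + ρs zero (rv zero) x       ≡⟨ cong (ρs (suc zero) b (lv zero) +_) (oneSum-resistance-HH (Ns zero) N′ NC (rv zero) x) ⟨
    ρs (suc zero) b (lv zero) + ρ (eH (rv zero)) (eH x)   ∎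
  cut (suc j) b = begin
    ρ (eK (emb′ (suc j) b)) (eH x)                        ≡⟨ across _ ⟩
    ρs zero x (rv zero) + ρ′ link (emb′ (suc j) b)
      ≡⟨ cong (ρs zero x (rv zero) +_) (trans (resistance-sym N′ link _) (chain-cut k Gs′ rv′ lv′ ρs′ Ns′ N′ j b (lv zero))) ⟩
    ρs zero x (rv zero) + (ρs (suc (suc j)) b (lv (suc j)) + ρ′ (glue′ j) link)
      ≡⟨ solve 3 (λ p q r → p :+ (q :+ r) := q :+ (p :+ r)) refl (ρs zero x (rv zero)) (ρs (suc (suc j)) b (lv (suc j))) (ρ′ (glue′ j) link) ⟩
    ρs (suc (suc j)) b (lv (suc j)) + (ρs zero x (rv zero) + ρ′ (glue′ j) link)
      ≡⟨ cong (λ r → ρs (suc (suc j)) b (lv (suc j)) + (ρs zero x (rv zero) + r)) (resistance-sym N′ (glue′ j) link) ⟩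
    ρs (suc (suc j)) b (lv (suc j)) + (ρs zero x (rv zero) + ρ′ link (glue′ j))
      ≡⟨ cong (ρs (suc (suc j)) b (lv (suc j)) +_) (across (glue′ j)) ⟨
    ρs (suc (suc j)) b (lv (suc j)) + ρ (eK (glue′ j)) (eH x) ∎

chain-moment-first : ∀ k Gs (rv : RV k Gs) (lv : LV k Gs) (ρs : Resistances k Gs) (Ns : ∀ i → IsNetwork (Gs i) (ρs i)) →
  ∀ {ρ} → IsNetwork (chainSum k Gs rv lv) ρ → ∀ x →
  μ (chainSum k Gs rv lv) ρ (emb k Gs rv lv zero x)
    ≡ μ (Gs zero) (ρs zero) x
      + Σℚ k (λ j → μ (Gs (suc j)) (ρs (suc j)) (lv j) + vol (Gs (suc j)) * ρ (glue k Gs rv lv j) (emb k Gs rv lv zero x))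
chain-moment-first k Gs rv lv ρs Ns {ρ} NC x =
  trans (chain-Σdeg k Gs rv lv (λ i → IsNetwork.simple (Ns i)) _)
        (cong₂ _+_ (Σdeg-cong (Gs zero) (λ a → chain-resistance-within k Gs rv lv ρs Ns NC zero a x))
                   (Σℚ-cong k (λ j → trans (Σdeg-cong (Gs (suc j)) (λ b → chain-cut k Gs rv lv ρs Ns NC j b x))
                                           (trans (Σdeg-+ (Gs (suc j)) (λ b → ρs (suc j) b (lv j)) (λ _ → ρ (glue k Gs rv lv j) (emb k Gs rv lv zero x)))
                                                  (cong (μ (Gs (suc j)) (ρs (suc j)) (lv j) +_) (Σdeg-const (Gs (suc j)) _))))))

-- The two correction terms of the theorem, weighted by volumes (vol = 2m) instead of edge counts.
cross : ∀ k Gs (rv : RV k Gs) (lv : LV k Gs) → Resistances k Gs → ℚ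
cross k Gs rv lv ρs = Σℚ (suc k) (λ i → vol (Gs i) * Σ≠ i (λ j p → μ (Gs j) (ρs j) (q k Gs rv lv i j p)))

links : ∀ k Gs (rv : RV k Gs) (lv : LV k Gs) → (V (chainSum k Gs rv lv) → V (chainSum k Gs rv lv) → ℚ) → ℚ
links k Gs rv lv ρ = Σℚ k (λ t → Σℚ k (λ s →
  if toℕ t <ᵇ toℕ s
  then (vol (Gs (inject₁ t)) * vol (Gs (suc s))) * ρ (glue k Gs rv lv t) (glue k Gs rv lv s)
  else 0ℚ))

q-irrelevant : ∀ k Gs (rv : RV k Gs) (lv : LV k Gs) i j (p p′ : i ≢ j) → q k Gs rv lv i j p ≡ q k Gs rv lv i j p′
q-irrelevant zero    Gs rv lv zero    zero    p p′ = ⊥-elim (p refl)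
q-irrelevant (suc k) Gs rv lv zero    zero    p p′ = ⊥-elim (p refl)
q-irrelevant (suc k) Gs rv lv zero    (suc j) p p′ = refl
q-irrelevant (suc k) Gs rv lv (suc i) zero    p p′ = refl
q-irrelevant (suc k) Gs rv lv (suc i) (suc j) p p′ = q-irrelevant k _ _ _ i j _ _

cross-suc : ∀ k Gs (rv : RV (suc k) Gs) (lv : LV (suc k) Gs) (ρs : Resistances (suc k) Gs) → (∀ i → IsSimple (Gs i)) →
  let open Tail Gs rv lv in
  cross (suc k) Gs rv lv ρs
    ≡ vol (Gs zero) * Σℚ (suc k) (λ j → μ (Gs (suc j)) (ρs (suc j)) (lv j))
      + (vol C′ * μ (Gs zero) (ρs zero) (rv zero) + cross k Gs′ rv′ lv′ (λ i → ρs (suc i)))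
cross-suc k Gs rv lv ρs simple = cong₂ _+_ (cong (vol (Gs zero) *_) (trans (Σ≠-ifNo zero (λ j p → M j (q (suc k) Gs rv lv zero j p))) (ℚ.+-identityˡ _))) (begin
  Σℚ (suc k) (λ i → vol (Gs′ i) * Σ≠ (suc i) (λ j p → M j (q (suc k) Gs rv lv (suc i) j p)))
    ≡⟨ Σℚ-cong (suc k) (λ i → trans (cong (vol (Gs′ i) *_) (row i)) (ℚ.*-distribˡ-+ (vol (Gs′ i)) μ₀ _)) ⟩
  Σℚ (suc k) (λ i → vol (Gs′ i) * μ₀ + vol (Gs′ i) * Σ≠ i (λ j p → M (suc j) (q k Gs′ rv′ lv′ i j p)))
    ≡⟨ Σℚ-+ (suc k) (λ i → vol (Gs′ i) * μ₀) (λ i → vol (Gs′ i) * Σ≠ i (λ j p → M (suc j) (q k Gs′ rv′ lv′ i j p))) ⟩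
  Σℚ (suc k) (λ i → vol (Gs′ i) * μ₀) + cross k Gs′ rv′ lv′ (λ i → ρs (suc i))
    ≡⟨ cong (_+ cross k Gs′ rv′ lv′ (λ i → ρs (suc i)))
            (trans (Σℚ-*ʳ (suc k) μ₀ (λ i → vol (Gs′ i))) (cong (_* μ₀) (sym (chain-vol k Gs′ rv′ lv′ (λ i → simple (suc i)))))) ⟩
  vol C′ * μ₀ + cross k Gs′ rv′ lv′ (λ i → ρs (suc i)) ∎)
  where
  open Tail Gs rv lv
  M : (j : Fin (suc (suc k))) → V (Gs j) → ℚ
  M j = μ (Gs j) (ρs j)
  μ₀ = M zero (rv zero)
  row : ∀ i → Σ≠ (suc i) (λ j p → M j (q (suc k) Gs rv lv (suc i) j p)) ≡ μ₀ + Σ≠ i (λ j p → M (suc j) (q k Gs′ rv′ lv′ i j p))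
  row i = trans (Σ≠-ifNo (suc i) (λ j p → M j (q (suc k) Gs rv lv (suc i) j p)))
    (cong (μ₀ +_) (sym (trans (Σ≠-ifNo i (λ j p → M (suc j) (q k Gs′ rv′ lv′ i j p))) (Σℚ-cong (suc k) pointwise))))
    where
    pointwise : ∀ j → ifNo (i ≟ j) (λ p → M (suc j) (q k Gs′ rv′ lv′ i j p))
                    ≡ ifNo (suc i ≟ suc j) (λ p → M (suc j) (q (suc k) Gs rv lv (suc i) (suc j) p))
    pointwise j with i ≟ j
    ... | yes _ = refl
    ... | no _  = cong (M (suc j)) (q-irrelevant k Gs′ rv′ lv′ i j _ _)

links-suc : ∀ k Gs (rv : RV (suc k) Gs) (lv : LV (suc k) Gs) (ρs : Resistances (suc k) Gs) (Ns : ∀ i → IsNetwork (Gs i) (ρs i)) →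
  ∀ {ρ} → IsNetwork (chainSum (suc k) Gs rv lv) ρ →
  let open TailNetwork Gs rv lv ρs Ns in
  links (suc k) Gs rv lv ρ ≡ vol (Gs zero) * Σℚ k (λ s → vol (Gs′ (suc s)) * ρ′ (glue′ s) link) + links k Gs′ rv′ lv′ ρ′
links-suc k Gs rv lv ρs Ns {ρ} NC = cong₂ _+_
  (trans (ℚ.+-identityˡ _) (trans (Σℚ-cong k (λ s → trans (ℚ.*-assoc (vol (Gs zero)) _ _) (cong (λ r → vol (Gs zero) * (vol (Gs′ (suc s)) * r)) (first s))))
                                  (Σℚ-*ˡ k (vol (Gs zero)) _)))
  (Σℚ-cong k (λ t → trans (ℚ.+-identityˡ _) (Σℚ-cong k (λ s →
    cong (λ r → if toℕ t <ᵇ toℕ s then (vol (Gs′ (inject₁ t)) * vol (Gs′ (suc s))) * r else 0ℚ)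
         (oneSum-resistance-KK (Ns zero) N′ NC (glue′ t) (glue′ s))))))
  where
  open TailNetwork Gs rv lv ρs Ns
  first : ∀ s → ρ (glue (suc k) Gs rv lv zero) (glue (suc k) Gs rv lv (suc s)) ≡ ρ′ (glue′ s) link
  first s = begin
    ρ (glue (suc k) Gs rv lv zero) (glue (suc k) Gs rv lv (suc s))  ≡⟨ oneSum-resistance-HK (Ns zero) N′ NC (rv zero) (glue′ s) ⟩
    ρs zero (rv zero) (rv zero) + ρ′ link (glue′ s)                  ≡⟨ cong (_+ ρ′ link (glue′ s)) (resistance-refl (IsNetwork.isResistance (Ns zero)) (rv zero)) ⟩
    0ℚ + ρ′ link (glue′ s)                                           ≡⟨ ℚ.+-identityˡ _ ⟩
    ρ′ link (glue′ s)                                                ≡⟨ resistance-sym N′ link (glue′ s) ⟩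
    ρ′ (glue′ s) link                                                ∎

chain-kemenySum : ∀ k Gs (rv : RV k Gs) (lv : LV k Gs) (ρs : Resistances k Gs) (Ns : ∀ i → IsNetwork (Gs i) (ρs i)) →
  ∀ {ρ} → IsNetwork (chainSum k Gs rv lv) ρ →
  kemenySum (chainSum k Gs rv lv) ρ
    ≡ Σℚ (suc k) (λ i → kemenySum (Gs i) (ρs i)) + ℕ→ℚ 2 * cross k Gs rv lv ρs + ℕ→ℚ 2 * links k Gs rv lv ρ
chain-kemenySum zero Gs rv lv ρs Ns {ρ} NC = begin
  kemenySum (Gs zero) ρ
    ≡⟨ Σℚ-cong (n (Gs zero)) (λ a → Σℚ-cong (n (Gs zero)) (λ b → cong ((ℕ→ℚ (deg (Gs zero) a) * ℕ→ℚ (deg (Gs zero) b)) *_) (network-unique NC (Ns zero) a b))) ⟩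
  kemenySum (Gs zero) (ρs zero)
    ≡⟨ solve 2 (λ S v → S := (S :+ con 0ℚ) :+ con (ℕ→ℚ 2) :* (v :* con 0ℚ :+ con 0ℚ) :+ con (ℕ→ℚ 2) :* con 0ℚ) refl
             (kemenySum (Gs zero) (ρs zero)) (vol (Gs zero)) ⟩
  (kemenySum (Gs zero) (ρs zero) + 0ℚ) + ℕ→ℚ 2 * cross zero Gs rv lv ρs + ℕ→ℚ 2 * 0ℚ ∎
chain-kemenySum (suc k) Gs rv lv ρs Ns {ρ} NC = begin
  kemenySum G ρ
    ≡⟨ oneSum-kemenySum (Ns zero) N′ NC ⟩
  (S₀ + kemenySum C′ ρ′) + ℕ→ℚ 2 * (vol C′ * μ₀ + vol (Gs zero) * μ C′ ρ′ link)
    ≡⟨ cong₂ (λ l r → (S₀ + l) + ℕ→ℚ 2 * (vol C′ * μ₀ + vol (Gs zero) * r))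
             (chain-kemenySum k Gs′ rv′ lv′ ρs′ Ns′ N′) moment-at-link ⟩
  (S₀ + (S′ + ℕ→ℚ 2 * X′ + ℕ→ℚ 2 * L′)) + ℕ→ℚ 2 * (vol C′ * μ₀ + vol (Gs zero) * (μ₁ + (A + B)))
    ≡⟨ solve 10 (λ S₀ S′ X′ L′ V′ m₀ V₀ m₁ A B →
         (S₀ :+ (S′ :+ con (ℕ→ℚ 2) :* X′ :+ con (ℕ→ℚ 2) :* L′)) :+ con (ℕ→ℚ 2) :* (V′ :* m₀ :+ V₀ :* (m₁ :+ (A :+ B)))
         := (S₀ :+ S′) :+ con (ℕ→ℚ 2) :* (V₀ :* (m₁ :+ A) :+ (V′ :* m₀ :+ X′)) :+ con (ℕ→ℚ 2) :* (V₀ :* B :+ L′))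
         refl S₀ S′ X′ L′ (vol C′) μ₀ (vol (Gs zero)) μ₁ A B ⟩
  (S₀ + S′) + ℕ→ℚ 2 * (vol (Gs zero) * (μ₁ + A) + (vol C′ * μ₀ + X′)) + ℕ→ℚ 2 * (vol (Gs zero) * B + L′)
    ≡⟨ cong₂ (λ x l → (S₀ + S′) + ℕ→ℚ 2 * x + ℕ→ℚ 2 * l)
             (sym (cross-suc k Gs rv lv ρs (λ i → IsNetwork.simple (Ns i)))) (sym (links-suc k Gs rv lv ρs Ns NC)) ⟩
  Σℚ (suc (suc k)) (λ i → kemenySum (Gs i) (ρs i)) + ℕ→ℚ 2 * cross (suc k) Gs rv lv ρs + ℕ→ℚ 2 * links (suc k) Gs rv lv ρ ∎
  where
  open TailNetwork Gs rv lv ρs Ns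
  G = chainSum (suc k) Gs rv lv
  S₀ = kemenySum (Gs zero) (ρs zero)
  S′ = Σℚ (suc k) (λ i → kemenySum (Gs′ i) (ρs′ i))
  X′ = cross k Gs′ rv′ lv′ ρs′
  L′ = links k Gs′ rv′ lv′ ρ′
  μ₀ = μ (Gs zero) (ρs zero) (rv zero)
  μ₁ = μ (Gs′ zero) (ρs′ zero) (lv zero)
  A = Σℚ k (λ j → μ (Gs′ (suc j)) (ρs′ (suc j)) (lv′ j))
  B = Σℚ k (λ s → vol (Gs′ (suc s)) * ρ′ (glue′ s) link)
  moment-at-link : μ C′ ρ′ link ≡ μ₁ + (A + B)
  moment-at-link = trans (chain-moment-first k Gs′ rv′ lv′ ρs′ Ns′ N′ (lv zero)) (cong (μ₁ +_) (Σℚ-+ k _ _))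

-- From volumes to edge counts

kemeny≡inv*kemenySum : ∀ {G} X → 1 ≤ edges G → kemeny G X ≡ inv (edges G) * (inv 4 * kemenySum G (resistance G X))
kemeny≡inv*kemenySum {G} X 1≤m =
  trans (cong (_* kemenySum G (resistance G X)) (trans (inv-homo-* {4} (s≤s z≤n) 1≤m) (ℚ.*-comm (inv 4) (inv (edges G)))))
        (ℚ.*-assoc (inv (edges G)) (inv 4) (kemenySum G (resistance G X)))

edges*kemeny : ∀ {G} X → 1 ≤ edges G → ℕ→ℚ (edges G) * kemeny G X ≡ inv 4 * kemenySum G (resistance G X)
edges*kemeny {G} X 1≤m = begin
  m * kemeny G X                                     ≡⟨ cong (m *_) (kemeny≡inv*kemenySum X 1≤m) ⟩
  m * (inv (edges G) * Q)                            ≡⟨ ℚ.*-assoc m (inv (edges G)) Q ⟨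
  (m * inv (edges G)) * Q                            ≡⟨ cong (_* Q) (ℕ→ℚ*inv≡1 1≤m) ⟩
  1ℚ * Q                                             ≡⟨ ℚ.*-identityˡ Q ⟩
  Q                                                  ∎
  where
  m = ℕ→ℚ (edges G)
  Q = inv 4 * kemenySum G (resistance G X)

chain-edges : ∀ k Gs (rv : RV k Gs) (lv : LV k Gs) → (∀ i → IsSimple (Gs i)) →
  edges (chainSum k Gs rv lv) ≡ Σℕ (suc k) (λ i → edges (Gs i))
chain-edges k Gs rv lv simple = ℕ→ℚ-injective (2*-injective (begin
  ℕ→ℚ 2 * ℕ→ℚ (edges (chainSum k Gs rv lv))     ≡⟨ handshake (chain-simple k Gs rv lv simple) ⟨
  vol (chainSum k Gs rv lv)                       ≡⟨ chain-vol k Gs rv lv simple ⟩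
  Σℚ (suc k) (λ i → vol (Gs i))                   ≡⟨ Σℚ-cong (suc k) (λ i → handshake (simple i)) ⟩
  Σℚ (suc k) (λ i → ℕ→ℚ 2 * E i)                  ≡⟨ Σℚ-*ˡ (suc k) (ℕ→ℚ 2) E ⟩
  ℕ→ℚ 2 * Σℚ (suc k) E                            ≡⟨ cong (ℕ→ℚ 2 *_) (ℕ→ℚ-homo-Σ (suc k) (λ i → edges (Gs i))) ⟨
  ℕ→ℚ 2 * ℕ→ℚ (Σℕ (suc k) (λ i → edges (Gs i)))  ∎))
  where
  E : Fin (suc k) → ℚ
  E i = ℕ→ℚ (edges (Gs i))

cross≡2*edges : ∀ k Gs (rv : RV k Gs) (lv : LV k Gs) (ρs : Resistances k Gs) → (∀ i → IsSimple (Gs i)) →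
  cross k Gs rv lv ρs ≡ ℕ→ℚ 2 * Σℚ (suc k) (λ i → ℕ→ℚ (edges (Gs i)) * Σ≠ i (λ j p → μ (Gs j) (ρs j) (q k Gs rv lv i j p)))
cross≡2*edges k Gs rv lv ρs simple =
  trans (Σℚ-cong (suc k) (λ i → trans (cong (_* SN i) (handshake (simple i))) (ℚ.*-assoc (ℕ→ℚ 2) (E i) (SN i))))
        (Σℚ-*ˡ (suc k) (ℕ→ℚ 2) (λ i → E i * SN i))
  where
  E SN : Fin (suc k) → ℚ
  E i = ℕ→ℚ (edges (Gs i))
  SN i = Σ≠ i (λ j p → μ (Gs j) (ρs j) (q k Gs rv lv i j p))

links≡4*edges : ∀ k Gs (rv : RV k Gs) (lv : LV k Gs) (ρ : V (chainSum k Gs rv lv) → V (chainSum k Gs rv lv) → ℚ) →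
  (∀ i → IsSimple (Gs i)) →
  links k Gs rv lv ρ ≡ ℕ→ℚ 4 * Σℚ k (λ t → Σℚ k (λ s →
    if toℕ t <ᵇ toℕ s
    then (ℕ→ℚ (edges (Gs (inject₁ t))) * ℕ→ℚ (edges (Gs (suc s)))) * ρ (glue k Gs rv lv t) (glue k Gs rv lv s)
    else 0ℚ))
links≡4*edges k Gs rv lv ρ simple =
  trans (Σℚ-cong k (λ t → trans (Σℚ-cong k (λ s → pair t s)) (Σℚ-*ˡ k (ℕ→ℚ 4) _))) (Σℚ-*ˡ k (ℕ→ℚ 4) _)
  where
  E : Fin (suc k) → ℚ
  E i = ℕ→ℚ (edges (Gs i))
  pair : ∀ t s → (if toℕ t <ᵇ toℕ s then (vol (Gs (inject₁ t)) * vol (Gs (suc s))) * ρ (glue k Gs rv lv t) (glue k Gs rv lv s) else 0ℚ)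
               ≡ ℕ→ℚ 4 * (if toℕ t <ᵇ toℕ s then (E (inject₁ t) * E (suc s)) * ρ (glue k Gs rv lv t) (glue k Gs rv lv s) else 0ℚ)
  pair t s = trans
    (cong (λ z → if toℕ t <ᵇ toℕ s then z else 0ℚ)
          (trans (cong₂ (λ a b → (a * b) * ρ (glue k Gs rv lv t) (glue k Gs rv lv s)) (handshake (simple (inject₁ t))) (handshake (simple (suc s))))
                 (solve 3 (λ a b r → ((con (ℕ→ℚ 2) :* a) :* (con (ℕ→ℚ 2) :* b)) :* r := con (ℕ→ℚ 4) :* ((a :* b) :* r)) refl
                        (E (inject₁ t)) (E (suc s)) (ρ (glue k Gs rv lv t) (glue k Gs rv lv s)))))
    (if-*ˡ (toℕ t <ᵇ toℕ s) (ℕ→ℚ 4) _)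

chain-kemenySum-edges : ∀ k Gs (rv : RV k Gs) (lv : LV k Gs) (Xs : (i : Fin (suc k)) → Mat (n (Gs i))) →
  (Ns : ∀ i → IsNetwork (Gs i) (resistance (Gs i) (Xs i))) → (∀ i → 1 ≤ edges (Gs i)) →
  ∀ {ρ} → IsNetwork (chainSum k Gs rv lv) ρ →
  inv 4 * kemenySum (chainSum k Gs rv lv) ρ
    ≡ Σℚ (suc k) (λ i → ℕ→ℚ (edges (Gs i)) * (kemeny (Gs i) (Xs i) + Σ≠ i (λ j p → moment (Gs j) (Xs j) (q k Gs rv lv i j p))))
      + ℕ→ℚ 2 * Σℚ k (λ t → Σℚ k (λ s →
          if toℕ t <ᵇ toℕ s
          then (ℕ→ℚ (edges (Gs (inject₁ t))) * ℕ→ℚ (edges (Gs (suc s)))) * ρ (glue k Gs rv lv t) (glue k Gs rv lv s)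
          else 0ℚ))
chain-kemenySum-edges k Gs rv lv Xs Ns 1≤edges {ρ} NC = begin
  inv 4 * kemenySum (chainSum k Gs rv lv) ρ
    ≡⟨ cong (inv 4 *_) (chain-kemenySum k Gs rv lv ρs Ns NC) ⟩
  inv 4 * (Σℚ (suc k) S + ℕ→ℚ 2 * cross k Gs rv lv ρs + ℕ→ℚ 2 * links k Gs rv lv ρ)
    ≡⟨ cong₂ (λ x l → inv 4 * (Σℚ (suc k) S + ℕ→ℚ 2 * x + ℕ→ℚ 2 * l))
             (cross≡2*edges k Gs rv lv ρs simple) (links≡4*edges k Gs rv lv ρ simple) ⟩
  inv 4 * (Σℚ (suc k) S + ℕ→ℚ 2 * (ℕ→ℚ 2 * B) + ℕ→ℚ 2 * (ℕ→ℚ 4 * P))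
    ≡⟨ solve 3 (λ ΣS B P → con (inv 4) :* (ΣS :+ con (ℕ→ℚ 2) :* (con (ℕ→ℚ 2) :* B) :+ con (ℕ→ℚ 2) :* (con (ℕ→ℚ 4) :* P))
                           := con (inv 4) :* ΣS :+ B :+ con (ℕ→ℚ 2) :* P) refl (Σℚ (suc k) S) B P ⟩
  inv 4 * Σℚ (suc k) S + B + ℕ→ℚ 2 * P
    ≡⟨ cong (λ z → z + B + ℕ→ℚ 2 * P)
            (trans (sym (Σℚ-*ˡ (suc k) (inv 4) S)) (Σℚ-cong (suc k) (λ i → sym (edges*kemeny (Xs i) (1≤edges i))))) ⟩
  Σℚ (suc k) (λ i → E i * kemeny (Gs i) (Xs i)) + B + ℕ→ℚ 2 * P
    ≡⟨ cong (_+ ℕ→ℚ 2 * P) (sym (trans (Σℚ-cong (suc k) (λ i → ℚ.*-distribˡ-+ (E i) (kemeny (Gs i) (Xs i)) (SN i)))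
                                                 (Σℚ-+ (suc k) (λ i → E i * kemeny (Gs i) (Xs i)) (λ i → E i * SN i)))) ⟩
  Σℚ (suc k) (λ i → E i * (kemeny (Gs i) (Xs i) + SN i)) + ℕ→ℚ 2 * P ∎
  where
  ρs : Resistances k Gs
  ρs i = resistance (Gs i) (Xs i)
  simple : ∀ i → IsSimple (Gs i)
  simple i = IsNetwork.simple (Ns i)
  E S SN : Fin (suc k) → ℚ
  E i = ℕ→ℚ (edges (Gs i))
  S i = kemenySum (Gs i) (ρs i)
  SN i = Σ≠ i (λ j p → moment (Gs j) (Xs j) (q k Gs rv lv i j p))
  B = Σℚ (suc k) (λ i → E i * SN i)
  P = Σℚ k (λ t → Σℚ k (λ s → if toℕ t <ᵇ toℕ s then (E (inject₁ t) * E (suc s)) * ρ (glue k Gs rv lv t) (glue k Gs rv lv s) else 0ℚ))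

theorem2p3 : (k : ℕ) (Gs : Fin (ℕ.suc k) → Graph) (rv : RV k Gs) (lv : LV k Gs) →
    (∀ i → IsSimple (Gs i)) → (∀ i → Connected (Gs i)) → (∀ i → 1 ≤ edges (Gs i)) →
    (Xs : (i : Fin (ℕ.suc k)) → Mat (n (Gs i))) →
    (∀ i → IsPseudoinverse (Laplacian (Gs i)) (Xs i)) →
    (X : Mat (n (chainSum k Gs rv lv))) →
    IsPseudoinverse (Laplacian (chainSum k Gs rv lv)) X →
    kemeny (chainSum k Gs rv lv) X ≡
      inv (Σℕ (ℕ.suc k) (λ i → edges (Gs i))) *
      (Σℚ (ℕ.suc k) (λ i → ℕ→ℚ (edges (Gs i)) *
          (kemeny (Gs i) (Xs i) +
           Σ≠ i (λ j p → moment (Gs j) (Xs j) (q k Gs rv lv i j p))))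
       + ℕ→ℚ 2 * Σℚ k (λ t → Σℚ k (λ s →
           if toℕ t <ᵇ toℕ s
           then (ℕ→ℚ (edges (Gs (inject₁ t))) * ℕ→ℚ (edges (Gs (suc s)))) *
                resistance (chainSum k Gs rv lv) X (glue k Gs rv lv t) (glue k Gs rv lv s)
           else 0ℚ)))
theorem2p3 k Gs rv lv simple connected 1≤edges Xs pinvs X pinv = begin
  kemeny C X                                               ≡⟨ kemeny≡inv*kemenySum X 1≤edgesC ⟩
  inv (edges C) * (inv 4 * kemenySum C (resistance C X))   ≡⟨ cong₂ (λ m z → inv m * z) edgesC
                                                                    (chain-kemenySum-edges k Gs rv lv Xs Ns 1≤edges NC) ⟩
  _                                                        ∎
  where
  C = chainSum k Gs rv lv
  Ns : ∀ i → IsNetwork (Gs i) (resistance (Gs i) (Xs i))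
  Ns i = pseudoinverse⇒network (simple i) (connected i) (pinvs i)
  NC : IsNetwork C (resistance C X)
  NC = let N = proj₂ (chain-network k Gs rv lv _ Ns) in pseudoinverse⇒network (IsNetwork.simple N) (IsNetwork.connected N) pinv
  edgesC : edges C ≡ Σℕ (suc k) (λ i → edges (Gs i))
  edgesC = chain-edges k Gs rv lv simple
  1≤edgesC : 1 ≤ edges C
  1≤edgesC = subst (1 ≤_) (sym edgesC) (ℕ.≤-trans (1≤edges zero) (ℕ.m≤m+n _ _))
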